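{- Let $m>0$ be an integer and for $T\ge2$ put $S_T(m)=\sum_{x\in\mathbb Z/2^T\mathbb Z}\exp\big(-\frac{2\pi i}{2^T}xm\big)\big(\frac2x\big)^T(1+i^x)$. Then: (1) If $T\ge4$ is even, $$S_T(m)=\begin{cases}2^T-2^{T-1},&2^T\mid m,\\ -2^{T-1},&2^{T-1}\|m,\\ 2^{T-1}\big(\frac{ -1}{m2^{2-T}}\big),&2^{T-2}\|m,\\ 0,&\text{otherwise.}\end{cases}$$ (2) If $T=2$, $S_2(m)=2$ if $4\mid m$, $S_2(m)=-2$ if $2\|m$, and $S_2(m)=2\big(\frac{ -1}{m}\big)$ if $m$ is odd. (3) If $T\ge5$ is odd, $S_T(m)=2^{T-\frac32}\big(\frac{2}{m2^{3-T}}\big)\big(1+\big(\frac{ -1}{m2^{3-T}}\big)\big)$ if $2^{T-3}\|m$, and $S_T(m)=0$ otherwise. (4) If $T=3$, $S_3(m)=2^{\frac32}\big(\frac2m\big)\big(1+\big(\frac{ -1}{m}\big)\big)$ if $m$ is odd, and $S_3(m)=0$ otherwise.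
   Context: $\big(\frac{2}{x}\big)$ is the Kronecker symbol, which vanishes for even $x$ (so only odd $x$ contribute), and $\big(\frac{ -1}{\cdot}\big)$, $\big(\frac{2}{\cdot}\big)$ evaluated at odd integers are the usual Kronecker/Jacobi symbols. -}

module Defs where

open import Data.Nat as ℕ using (ℕ; zero; suc; _∸_; _≟_; _<ᵇ_)
open import Data.Nat.Properties using (m^n≢0)
open import Data.Integer as ℤ using (ℤ; +_; -_; _%ℕ_)
open import Data.Fin using (Fin; toℕ)
open import Data.Vec using (Vec; tabulate; zipWith; replicate; lookup)
open import Data.List using (List; upTo; foldr; allFin)
open import Data.Nat.Divisibility using (_∣_)
open import Data.Product using (_×_)
open import Relation.Nullary using (¬_)
open import Data.Bool using (if_then_else_)
open import Relation.Nullary.Decidable using (does)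

-- The cyclotomic ring  ℤ[ζ],  ζ = exp(2πi / 2^T)  (T ≥ 1).
-- Its minimal polynomial is X^(2^(T-1)) + 1, so ℤ[ζ] ≅ ℤ[X]/(X^(2^(T-1))+1)
-- and an element is uniquely given by its coefficient vector w.r.t. the
-- basis 1, ζ, …, ζ^(2^(T-1)-1).  The evaluation X ↦ exp(2πi/2^T) is an
-- injective ring map into ℂ, so identities in ℂ between elements of ℤ[ζ]
-- are exactly equalities of coefficient vectors.

half : ℕ → ℕ
half T = 2 ℕ.^ (T ∸ 1)

record Cyc (T : ℕ) : Set where
  constructor cyc
  field coeffs : Vec ℤ (half T)
open Cyc public

-- ζ^j for an integer exponent j (ζ^(2^(T-1)) = -1)
ζ^ : (T : ℕ) → ℤ → Cyc T
ζ^ T j = cyc (tabulate coeff)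
  where
  r : ℕ
  r = (j %ℕ (2 ℕ.^ T)) {{m^n≢0 2 T}}
  coeff : Fin (half T) → ℤ
  coeff k = if does (r ≟ toℕ k) then + 1
            else if does (r ≟ toℕ k ℕ.+ half T) then - (+ 1)
            else + 0

zeroC : (T : ℕ) → Cyc T
zeroC T = cyc (replicate _ (+ 0))

oneC : (T : ℕ) → Cyc T
oneC T = ζ^ T (+ 0)

_⊕_ : {T : ℕ} → Cyc T → Cyc T → Cyc T
cyc a ⊕ cyc b = cyc (zipWith ℤ._+_ a b)
infixl 6 _⊕_

_•_ : {T : ℕ} → ℤ → Cyc T → Cyc T
c • cyc v = cyc (Data.Vec.map (c ℤ.*_) v)
infixl 7 _•_

sumC : (T : ℕ) → ℕ → (ℕ → Cyc T) → Cyc T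
sumC T n f = foldr (λ x acc → f x ⊕ acc) (zeroC T) (upTo n)

sumFin : (T n : ℕ) → (Fin n → Cyc T) → Cyc T
sumFin T n f = foldr (λ x acc → f x ⊕ acc) (zeroC T) (allFin n)

_⊗_ : {T : ℕ} → Cyc T → Cyc T → Cyc T
_⊗_ {T} a b =
  sumFin T (half T) (λ i → sumFin T (half T) (λ j →
    (lookup (coeffs a) i ℤ.* lookup (coeffs b) j) • ζ^ T (+ (toℕ i ℕ.+ toℕ j))))
infixl 7 _⊗_

_^C_ : {T : ℕ} → Cyc T → ℕ → Cyc T
_^C_ {T} v zero    = oneC T
_^C_ {T} v (suc n) = v ⊗ (v ^C n)

-- the imaginary unit  i = ζ^(2^(T-2))   (T ≥ 2)
iC : (T : ℕ) → Cyc T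
iC T = ζ^ T (+ (2 ℕ.^ (T ∸ 2)))

-- exp(-2πi x m / 2^T) = ζ^(-x m)
e : (T : ℕ) → ℕ → ℕ → Cyc T
e T x m = ζ^ T (- (+ (x ℕ.* m)))

-- √2 = ζ_8 + ζ_8⁻¹ = ζ^(2^(T-3)) + ζ^(-2^(T-3))   (T ≥ 3)
sqrt2 : (T : ℕ) → Cyc T
sqrt2 T = ζ^ T (+ (2 ℕ.^ (T ∸ 3))) ⊕ ζ^ T (- (+ (2 ℕ.^ (T ∸ 3))))

kron2 : ℕ → ℤ
kron2 x with x ℕ.% 8
... | 1 = + 1
... | 7 = + 1
... | 3 = - (+ 1)
... | 5 = - (+ 1)
... | _ = + 0

-- Jacobi symbol (-1/n) for odd n: 1 if n ≡ 1 (mod 4), -1 if n ≡ 3 (mod 4).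
-- (Only ever applied to odd arguments below; value 0 on even n is a dummy.)
jacNeg1 : ℕ → ℤ
jacNeg1 n with n ℕ.% 4
... | 1 = + 1
... | 3 = - (+ 1)
... | _ = + 0

-- S_T(m) = Σ_{x ∈ ℤ/2^T} exp(-2πi x m / 2^T) (2/x)^T (1 + i^x),
-- x running over the representatives 0, …, 2^T - 1.
S : (T m : ℕ) → Cyc T
S T m = sumC T (2 ℕ.^ T) (λ x →
  (kron2 x ℤ.^ T) • (e T x m ⊗ (oneC T ⊕ (iC T ^C x))))

const : (T : ℕ) → ℤ → Cyc T
const T c = c • oneC T

_∥_ : ℕ → ℕ → Set
d ∥ m = (d ∣ m) × ¬ (2 ℕ.* d ∣ m)
infix 4 _∥_

{-# OPTIONS --safe #-}
-- Let ζ = exp(2πi/2^T), χ = (2/·) and q = 2^(T-2), so that i = ζ^q and the x-th summand of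
-- S_T(m) is χ(x)^T (ζ^(-xm) + ζ^(x(q-m))). The weight χ^T is the indicator of odd x when T is
-- even, and is χ itself, of period 8, when T is odd. Writing x = y·2^s + r along that period
-- 2^s turns each sum over y into a sum over the 2^(T-s)-th roots of unity: for a frequency
-- a ∈ {-m, q-m} it is 2^(T-s) ζ^(ra) if 2^(T-s) ∣ a and 0 otherwise. For even T only r = 1
-- survives, and the four cases record which of -m and q-m are divisible by 2^(T-1). For odd T
-- everything vanishes unless m = t·2^(T-3), and then S_T(m) = 2^(T-3) (G(-t) + G(2-t)), where
-- G(a) = Σ_{r mod 8} χ(r) ζ₈^(ra) is the Gauss sum of χ, read in ℤ[ζ₈] ⊆ ℤ[ζ]. Evaluating it
-- in ℤ[ζ₈] gives G(a) = 2χ(a)√2, and χ(-t) + χ(2-t) = χ(t)(1 + (-1/t)).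
module Submission where

open import Defs
open import Data.Nat using (ℕ; _≤_; _<_; _∸_; _^_; _/_; _%_)
open import Data.Nat.Properties using (m^n≢0)
open import Data.Nat.Divisibility using (_∣_)
open import Data.Integer using (+_; -_)
open import Data.Product using (_×_)
open import Relation.Nullary using (¬_)
open import Relation.Binary.PropositionalEquality using (_≡_)

open import Data.Nat as ℕ using (zero; suc; s≤s; z≤n; _≟_)
import Data.Nat.Properties as ℕP
open import Data.Nat.Properties using (allUpTo?)
import Data.Nat.DivMod as ℕD
open import Data.Integer as ℤ using (ℤ; _+_; _*_; _-_; _%ℕ_; _/ℕ_)
open import Data.Integer.DivMod using (a≡a%ℕn+[a/ℕn]*n; n%ℕd<d)
import Data.Integer.Properties as ℤP
open import Data.Fin as Fin using (Fin; toℕ)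
import Data.Fin.Properties as FinP
open import Data.Vec using (lookup; tabulate)
import Data.Vec.Properties as Vec
open import Data.List using (List; []; _∷_; map; length; foldr; upTo; allFin)
import Data.List.Properties as List
open import Data.Bool as Bool using (true; false; if_then_else_)
open import Relation.Nullary.Decidable using (Dec; does; yes; no; True; toWitness)
open import Data.Empty using (⊥-elim)
open import Data.Sum using (_⊎_; inj₁; inj₂)
open import Data.Product using (∃-syntax; _,_)
open import Data.Integer.Divisibility.Signed using (divides) renaming (_∣_ to _∣ℤ_)
import Data.Integer.Divisibility.Signed as ℤ∣
open import Relation.Binary.PropositionalEquality using (refl; sym; trans; cong; cong₂; subst; module ≡-Reasoning)
open import Function using (_∘_; id)
open import Data.Integer.Tactic.RingSolver using (solve-∀)
import Data.Nat.Tactic.RingSolver as ℕSolver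
import Data.Nat.Divisibility as ℕ∣

-- The ℤ-module of coefficient vectors

coeff : {T : ℕ} → Cyc T → Fin (half T) → ℤ
coeff u = lookup (coeffs u)

coeff-injective : {T : ℕ} {u v : Cyc T} → (∀ k → coeff u k ≡ coeff v k) → u ≡ v
coeff-injective {u = cyc a} {cyc b} same = cong cyc (begin
  a                  ≡⟨ Vec.tabulate∘lookup a ⟨
  tabulate (lookup a) ≡⟨ Vec.tabulate-cong same ⟩
  tabulate (lookup b) ≡⟨ Vec.tabulate∘lookup b ⟩
  b                  ∎)
  where open ≡-Reasoning

-- A record rather than a function type, so that the coefficient expression f is
-- inferred from the combinators that build the proof.
record HasCoeffs {T : ℕ} (u : Cyc T) (f : Fin (half T) → ℤ) : Set where
  constructor has
  field coeff≡ : ∀ k → coeff u k ≡ f k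
open HasCoeffs

has-coeff : {T : ℕ} (u : Cyc T) → HasCoeffs u (coeff u)
has-coeff u = has λ _ → refl

has-⊕ : {T : ℕ} {u v : Cyc T} {f g : Fin (half T) → ℤ} →
        HasCoeffs u f → HasCoeffs v g → HasCoeffs (u ⊕ v) (λ k → f k + g k)
has-⊕ {u = u} {v} p q = has λ k →
  trans (Vec.lookup-zipWith _+_ k (coeffs u) (coeffs v)) (cong₂ _+_ (coeff≡ p k) (coeff≡ q k))

has-• : {T : ℕ} (c : ℤ) {u : Cyc T} {f : Fin (half T) → ℤ} →
        HasCoeffs u f → HasCoeffs (c • u) (λ k → c * f k)
has-• c {u} p = has λ k → trans (Vec.lookup-map k (c *_) (coeffs u)) (cong (c *_) (coeff≡ p k))

has-zero : {T : ℕ} → HasCoeffs (zeroC T) (λ _ → + 0)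
has-zero = has λ k → Vec.lookup-replicate k (+ 0)

≡-via-coeffs : {T : ℕ} {u v : Cyc T} {f g : Fin (half T) → ℤ} →
               HasCoeffs u f → HasCoeffs v g → (∀ k → f k ≡ g k) → u ≡ v
≡-via-coeffs p q f≡g = coeff-injective λ k → trans (coeff≡ p k) (trans (f≡g k) (sym (coeff≡ q k)))

module _ {T : ℕ} where

  ⊕-assoc : (u v w : Cyc T) → (u ⊕ v) ⊕ w ≡ u ⊕ (v ⊕ w)
  ⊕-assoc u v w = ≡-via-coeffs (has-⊕ (has-⊕ (has-coeff u) (has-coeff v)) (has-coeff w))
    (has-⊕ (has-coeff u) (has-⊕ (has-coeff v) (has-coeff w))) λ k → ℤP.+-assoc (coeff u k) _ _

  ⊕-identityˡ : (u : Cyc T) → zeroC T ⊕ u ≡ u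
  ⊕-identityˡ u = ≡-via-coeffs (has-⊕ has-zero (has-coeff u)) (has-coeff u) λ _ → ℤP.+-identityˡ _

  ⊕-identityʳ : (u : Cyc T) → u ⊕ zeroC T ≡ u
  ⊕-identityʳ u = ≡-via-coeffs (has-⊕ (has-coeff u) has-zero) (has-coeff u) λ _ → ℤP.+-identityʳ _

  ⊕-interchange : (u v w x : Cyc T) → (u ⊕ v) ⊕ (w ⊕ x) ≡ (u ⊕ w) ⊕ (v ⊕ x)
  ⊕-interchange u v w x =
    ≡-via-coeffs (has-⊕ (has-⊕ (has-coeff u) (has-coeff v)) (has-⊕ (has-coeff w) (has-coeff x)))
                 (has-⊕ (has-⊕ (has-coeff u) (has-coeff w)) (has-⊕ (has-coeff v) (has-coeff x)))
                 λ k → interchange (coeff u k) (coeff v k) (coeff w k) (coeff x k)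
    where interchange : ∀ a b c d → (a + b) + (c + d) ≡ (a + c) + (b + d)
          interchange = solve-∀

  •-zeroˡ : (u : Cyc T) → + 0 • u ≡ zeroC T
  •-zeroˡ u = ≡-via-coeffs (has-• (+ 0) (has-coeff u)) has-zero λ _ → refl

  •-zeroʳ : (c : ℤ) → c • zeroC T ≡ zeroC T
  •-zeroʳ c = ≡-via-coeffs (has-• c has-zero) has-zero λ _ → ℤP.*-zeroʳ c

  •-identityˡ : (u : Cyc T) → + 1 • u ≡ u
  •-identityˡ u = ≡-via-coeffs (has-• (+ 1) (has-coeff u)) (has-coeff u) λ _ → ℤP.*-identityˡ _

  •-assoc : (c d : ℤ) (u : Cyc T) → c • (d • u) ≡ (c * d) • u
  •-assoc c d u = ≡-via-coeffs (has-• c (has-• d (has-coeff u))) (has-• (c * d) (has-coeff u))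
    λ _ → sym (ℤP.*-assoc c d _)

  •-distribˡ-⊕ : (c : ℤ) (u v : Cyc T) → c • (u ⊕ v) ≡ c • u ⊕ c • v
  •-distribˡ-⊕ c u v = ≡-via-coeffs (has-• c (has-⊕ (has-coeff u) (has-coeff v)))
    (has-⊕ (has-• c (has-coeff u)) (has-• c (has-coeff v))) λ _ → ℤP.*-distribˡ-+ c _ _

  •-distribʳ-+ : (c d : ℤ) (u : Cyc T) → (c + d) • u ≡ c • u ⊕ d • u
  •-distribʳ-+ c d u = ≡-via-coeffs (has-• (c + d) (has-coeff u))
    (has-⊕ (has-• c (has-coeff u)) (has-• d (has-coeff u))) λ _ → ℤP.*-distribʳ-+ _ c d

  ⊕-cancel-neg : (u : Cyc T) → u ⊕ - + 1 • u ≡ zeroC T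
  ⊕-cancel-neg u = ≡-via-coeffs (has-⊕ (has-coeff u) (has-• (- + 1) (has-coeff u))) has-zero
    λ k → cancel (coeff u k)
    where cancel : ∀ a → a + - + 1 * a ≡ + 0
          cancel = solve-∀

  •-neg-involutive : (u : Cyc T) → - + 1 • (- + 1 • u) ≡ u
  •-neg-involutive u = trans (•-assoc (- + 1) (- + 1) u) (•-identityˡ u)

-- Finite sums

∑ : {A : Set} {T : ℕ} → List A → (A → Cyc T) → Cyc T
∑ {T = T} []       f = zeroC T
∑         (x ∷ xs) f = f x ⊕ ∑ xs f

syntax ∑ xs (λ x → t) = ∑[ x ← xs ] t

module _ {A : Set} {T : ℕ} where

  foldr≡∑ : (xs : List A) (f : A → Cyc T) → foldr (λ x acc → f x ⊕ acc) (zeroC T) xs ≡ ∑ xs f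
  foldr≡∑ []       f = refl
  foldr≡∑ (x ∷ xs) f = cong (f x ⊕_) (foldr≡∑ xs f)

  ∑-cong : (xs : List A) {f g : A → Cyc T} → (∀ x → f x ≡ g x) → ∑ xs f ≡ ∑ xs g
  ∑-cong []       f≡g = refl
  ∑-cong (x ∷ xs) f≡g = cong₂ _⊕_ (f≡g x) (∑-cong xs f≡g)

  ∑-vanishes : (xs : List A) {f : A → Cyc T} → (∀ x → f x ≡ zeroC T) → ∑ xs f ≡ zeroC T
  ∑-vanishes []       f≡0 = refl
  ∑-vanishes (x ∷ xs) f≡0 = trans (cong₂ _⊕_ (f≡0 x) (∑-vanishes xs f≡0)) (⊕-identityˡ _)

  ∑-distrib-⊕ : (xs : List A) (f g : A → Cyc T) → ∑[ x ← xs ] (f x ⊕ g x) ≡ ∑ xs f ⊕ ∑ xs g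
  ∑-distrib-⊕ []       f g = sym (⊕-identityˡ _)
  ∑-distrib-⊕ (x ∷ xs) f g =
    trans (cong (f x ⊕ g x ⊕_) (∑-distrib-⊕ xs f g)) (⊕-interchange _ _ _ _)

  •-distrib-∑ : (c : ℤ) (xs : List A) (f : A → Cyc T) → c • ∑ xs f ≡ ∑[ x ← xs ] (c • f x)
  •-distrib-∑ c []       f = •-zeroʳ c
  •-distrib-∑ c (x ∷ xs) f = trans (•-distribˡ-⊕ c _ _) (cong (c • f x ⊕_) (•-distrib-∑ c xs f))

  ∑-const : (xs : List A) (u : Cyc T) → ∑[ _ ← xs ] u ≡ + length xs • u
  ∑-const []       u = sym (•-zeroˡ u)
  ∑-const (x ∷ xs) u = begin
    u ⊕ ∑[ _ ← xs ] u          ≡⟨ cong₂ _⊕_ (sym (•-identityˡ u)) (∑-const xs u) ⟩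
    + 1 • u ⊕ + length xs • u  ≡⟨ •-distribʳ-+ (+ 1) (+ length xs) u ⟨
    + length (x ∷ xs) • u      ∎
    where open ≡-Reasoning

∑-comm : {A B : Set} {T : ℕ} (xs : List A) (ys : List B) (H : A → B → Cyc T) →
         ∑[ x ← xs ] ∑[ y ← ys ] H x y ≡ ∑[ y ← ys ] ∑[ x ← xs ] H x y
∑-comm []       ys H = sym (∑-vanishes ys λ _ → refl)
∑-comm (x ∷ xs) ys H =
  trans (cong (∑ ys (H x) ⊕_) (∑-comm xs ys H)) (sym (∑-distrib-⊕ ys (H x) _))

∑-map : {A B : Set} {T : ℕ} (g : B → A) (xs : List B) (f : A → Cyc T) → ∑ (map g xs) f ≡ ∑ xs (f ∘ g)
∑-map g []       f = refl
∑-map g (x ∷ xs) f = cong (f (g x) ⊕_) (∑-map g xs f)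

module _ {T : ℕ} where

  ∑-upTo-suc : (n : ℕ) (f : ℕ → Cyc T) → ∑ (upTo (suc n)) f ≡ f 0 ⊕ ∑ (upTo n) (f ∘ suc)
  ∑-upTo-suc n f = cong (f 0 ⊕_) (trans (cong (λ xs → ∑ xs f) (sym (List.map-upTo suc n))) (∑-map suc (upTo n) f))

  ∑-upTo-+ : (a b : ℕ) (f : ℕ → Cyc T) → ∑ (upTo (a ℕ.+ b)) f ≡ ∑ (upTo a) f ⊕ ∑[ y ← upTo b ] f (a ℕ.+ y)
  ∑-upTo-+ zero    b f = sym (⊕-identityˡ _)
  ∑-upTo-+ (suc a) b f = begin
    ∑ (upTo (suc a ℕ.+ b)) f                                  ≡⟨ ∑-upTo-suc (a ℕ.+ b) f ⟩
    f 0 ⊕ ∑ (upTo (a ℕ.+ b)) (f ∘ suc)                        ≡⟨ cong (f 0 ⊕_) (∑-upTo-+ a b (f ∘ suc)) ⟩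
    f 0 ⊕ (∑ (upTo a) (f ∘ suc) ⊕ ∑[ y ← upTo b ] f (suc a ℕ.+ y)) ≡⟨ ⊕-assoc _ _ _ ⟨
    (f 0 ⊕ ∑ (upTo a) (f ∘ suc)) ⊕ ∑[ y ← upTo b ] f (suc a ℕ.+ y) ≡⟨ cong (_⊕ ∑[ y ← upTo b ] f (suc a ℕ.+ y)) (∑-upTo-suc a f) ⟨
    ∑ (upTo (suc a)) f ⊕ ∑[ y ← upTo b ] f (suc a ℕ.+ y)      ∎
    where open ≡-Reasoning

  ∑-upTo-* : (N b : ℕ) (f : ℕ → Cyc T) →
             ∑ (upTo (N ℕ.* b)) f ≡ ∑[ y ← upTo N ] ∑[ r ← upTo b ] f (y ℕ.* b ℕ.+ r)
  ∑-upTo-* zero    b f = refl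
  ∑-upTo-* (suc N) b f = begin
    ∑ (upTo (b ℕ.+ N ℕ.* b)) f
      ≡⟨ ∑-upTo-+ b (N ℕ.* b) f ⟩
    ∑ (upTo b) f ⊕ ∑[ x ← upTo (N ℕ.* b) ] f (b ℕ.+ x)
      ≡⟨ cong (∑ (upTo b) f ⊕_) (∑-upTo-* N b (λ x → f (b ℕ.+ x))) ⟩
    ∑ (upTo b) f ⊕ ∑[ y ← upTo N ] ∑[ r ← upTo b ] f (b ℕ.+ (y ℕ.* b ℕ.+ r))
      ≡⟨ cong (∑ (upTo b) f ⊕_) (∑-cong (upTo N) λ y → ∑-cong (upTo b) λ r →
           cong f (sym (ℕP.+-assoc b (y ℕ.* b) r))) ⟩
    ∑ (upTo b) f ⊕ ∑[ y ← upTo N ] ∑[ r ← upTo b ] f (suc y ℕ.* b ℕ.+ r)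
      ≡⟨ ∑-upTo-suc N (λ y → ∑[ r ← upTo b ] f (y ℕ.* b ℕ.+ r)) ⟨
    ∑[ y ← upTo (suc N) ] ∑[ r ← upTo b ] f (y ℕ.* b ℕ.+ r) ∎
    where open ≡-Reasoning

  ∑-allFin-suc : (n : ℕ) (f : Fin (suc n) → Cyc T) → ∑ (allFin (suc n)) f ≡ f Fin.zero ⊕ ∑ (allFin n) (f ∘ Fin.suc)
  ∑-allFin-suc n f = cong (f Fin.zero ⊕_) (trans (cong (λ xs → ∑ xs f) (sym (List.map-tabulate id Fin.suc))) (∑-map Fin.suc (allFin n) f))

δ : {n : ℕ} → ℕ → Fin n → ℤ
δ r k = if does (r ≟ toℕ k) then + 1 else + 0

∑-δ : {T n r : ℕ} → r < n → (g : ℕ → Cyc T) → ∑[ k ← allFin n ] (δ r k • g (toℕ k)) ≡ g r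
∑-δ {n = suc n} {zero} _ g = begin
  ∑[ k ← allFin (suc n) ] (δ 0 k • g (toℕ k))       ≡⟨ ∑-allFin-suc n _ ⟩
  + 1 • g 0 ⊕ ∑[ k ← allFin n ] (+ 0 • g (suc (toℕ k))) ≡⟨ cong₂ _⊕_ (•-identityˡ (g 0)) (∑-vanishes (allFin n) λ _ → •-zeroˡ _) ⟩
  g 0 ⊕ zeroC _                                    ≡⟨ ⊕-identityʳ (g 0) ⟩
  g 0                                              ∎
  where open ≡-Reasoning
∑-δ {n = suc n} {suc r} (s≤s r<n) g = begin
  ∑[ k ← allFin (suc n) ] (δ (suc r) k • g (toℕ k))    ≡⟨ ∑-allFin-suc n _ ⟩
  + 0 • g 0 ⊕ ∑[ k ← allFin n ] (δ r k • g (suc (toℕ k))) ≡⟨ cong₂ _⊕_ (•-zeroˡ (g 0)) (∑-δ r<n (g ∘ suc)) ⟩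
  zeroC _ ⊕ g (suc r)                                  ≡⟨ ⊕-identityˡ _ ⟩
  g (suc r)                                            ∎
  where open ≡-Reasoning

-- Residues and divisibility

module _ (d : ℕ) .{{_ : ℕ.NonZero d}} where

  private
    remainder-unique⁺ : {a b : ℕ} (n : ℕ) → a < d → b < d → + a ≡ + b + + n * + d → a ≡ b
    remainder-unique⁺ {a} {b} n a<d b<d a≡b+nd = begin
      a                   ≡⟨ ℕD.m<n⇒m%n≡m a<d ⟨
      a % d               ≡⟨ cong (_% d) (ℤP.+-injective (trans a≡b+nd (cong (_+_ (+ b)) (sym (ℤP.pos-* n d))))) ⟩
      (b ℕ.+ n ℕ.* d) % d ≡⟨ ℕD.[m+kn]%n≡m%n b n d ⟩
      b % d               ≡⟨ ℕD.m<n⇒m%n≡m b<d ⟩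
      b                   ∎
      where open ≡-Reasoning

  remainder-unique : {a b : ℕ} (k : ℤ) → a < d → b < d → + a ≡ + b + k * + d → a ≡ b
  remainder-unique (+ n)      a<d b<d eq = remainder-unique⁺ n a<d b<d eq
  remainder-unique {a} {b} ℤ.-[1+ n ] a<d b<d eq =
    sym (remainder-unique⁺ (suc n) b<d a<d (trans (shift (+ b) (+ suc n) (+ d)) (cong (_+ + suc n * + d) (sym eq))))
    where shift : ∀ b n d → b ≡ (b + - n * d) + n * d
          shift = solve-∀

  %ℕ-unique : (j : ℤ) {r : ℕ} (k : ℤ) → r < d → j ≡ + r + k * + d → j %ℕ d ≡ r
  %ℕ-unique j {r} k r<d j≡r+kd = remainder-unique (k - j /ℕ d) (n%ℕd<d j d) r<d (begin
    + (j %ℕ d)                                 ≡⟨ move (+ (j %ℕ d)) (j /ℕ d) (+ d) ⟩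
    (+ (j %ℕ d) + j /ℕ d * + d) - j /ℕ d * + d ≡⟨ cong (_- j /ℕ d * + d) (a≡a%ℕn+[a/ℕn]*n j d) ⟨
    j - j /ℕ d * + d                           ≡⟨ cong (_- j /ℕ d * + d) j≡r+kd ⟩
    (+ r + k * + d) - j /ℕ d * + d             ≡⟨ regroup (+ r) k (j /ℕ d) (+ d) ⟩
    + r + (k - j /ℕ d) * + d                   ∎)
    where
    open ≡-Reasoning
    move : ∀ a q d → a ≡ (a + q * d) - q * d
    move = solve-∀
    regroup : ∀ r k q d → (r + k * d) - q * d ≡ r + (k - q) * d
    regroup = solve-∀

  %ℕ-cong : {j : ℤ} (i k : ℤ) → j ≡ i + k * + d → j %ℕ d ≡ i %ℕ d
  %ℕ-cong {j} i k j≡i+kd = %ℕ-unique j (i /ℕ d + k) (n%ℕd<d i d) (begin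
    j                                     ≡⟨ j≡i+kd ⟩
    i + k * + d                           ≡⟨ cong (_+ k * + d) (a≡a%ℕn+[a/ℕn]*n i d) ⟩
    (+ (i %ℕ d) + i /ℕ d * + d) + k * + d ≡⟨ regroup (+ (i %ℕ d)) (i /ℕ d) k (+ d) ⟩
    + (i %ℕ d) + (i /ℕ d + k) * + d       ∎)
    where
    open ≡-Reasoning
    regroup : ∀ r q k d → (r + q * d) + k * d ≡ r + (q + k) * d
    regroup = solve-∀

ℕ-even-or-odd : (t : ℕ) → (∃[ u ] t ≡ u ℕ.* 2) ⊎ (∃[ u ] t ≡ 1 ℕ.+ u ℕ.* 2)
ℕ-even-or-odd t with t % 2 | ℕD.m%n<n t 2 | ℕD.m≡m%n+[m/n]*n t 2
... | 0 | _ | t≡2u   = inj₁ (t / 2 , t≡2u)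
... | 1 | _ | t≡1+2u = inj₂ (t / 2 , t≡1+2u)
... | suc (suc _) | s≤s (s≤s ()) | _

∥⇒odd-multiple : {d m : ℕ} → d ∥ m → ∃[ u ] m ≡ (1 ℕ.+ u ℕ.* 2) ℕ.* d
∥⇒odd-multiple {d} (ℕ∣.divides t m≡td , 2d∤m) with ℕ-even-or-odd t
... | inj₁ (u , refl) = ⊥-elim (2d∤m (ℕ∣.divides u (trans m≡td (ℕP.*-assoc u 2 d))))
... | inj₂ (u , refl) = u , m≡td

∣ℤ⇒∣ : {d m : ℕ} → + d ∣ℤ + m → d ∣ m
∣ℤ⇒∣ = ℤ∣.∣⇒∣ᵤ

∣ℤ-neg⇒∣ : {d m : ℕ} → + d ∣ℤ - + m → d ∣ m
∣ℤ-neg⇒∣ {d} {m} d∣-m = subst (d ∣_) (ℤP.∣-i∣≡∣i∣ (+ m)) (ℤ∣.∣⇒∣ᵤ d∣-m)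

-- Powers of ζ

-- In goals, does (m ≟ n) shows up already reduced to m ≡ᵇ n, so the case
-- splits on coefficients of ζ^ below are on _≡ᵇ_.
≡ᵇ⇒≡ : {m n : ℕ} → (m ℕ.≡ᵇ n) ≡ true → m ≡ n
≡ᵇ⇒≡ {m} {n} eq = ℕP.≡ᵇ⇒≡ m n (subst Bool.T (sym eq) _)

≡ᵇ⇒≢ : {m n : ℕ} → (m ℕ.≡ᵇ n) ≡ false → ¬ m ≡ n
≡ᵇ⇒≢ {m} {n} eq m≡n = subst Bool.T eq (ℕP.≡⇒≡ᵇ m n m≡n)

-- ζ^ T j unfolds to ζ^residue T (j %ℕ 2 ^ T): residueCoeff is the coefficient
-- function from the definition of ζ^.
residueCoeff : (T r : ℕ) → Fin (half T) → ℤ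
residueCoeff T r k = if does (r ≟ toℕ k) then + 1
                     else if does (r ≟ toℕ k ℕ.+ half T) then - (+ 1)
                     else + 0

ζ^residue : (T r : ℕ) → Cyc T
ζ^residue T r = cyc (tabulate (residueCoeff T r))

ζ^-cong-mod : (T : ℕ) {j : ℤ} (i k : ℤ) → j ≡ i + k * + (2 ^ T) → ζ^ T j ≡ ζ^ T i
ζ^-cong-mod T i k j≡i+kP = cong (ζ^residue T) (%ℕ-cong (2 ^ T) {{m^n≢0 2 T}} i k j≡i+kP)

half≤2^ : (T : ℕ) → half T ≤ 2 ^ T
half≤2^ zero    = ℕP.≤-refl
half≤2^ (suc T) = ℕP.m≤m+n (2 ^ T) _

coeff-ζ^-low : (T : ℕ) {r : ℕ} → r < half T → (k : Fin (half T)) → coeff (ζ^ T (+ r)) k ≡ δ r k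
coeff-ζ^-low T {r} r<h k = begin
  coeff (ζ^ T (+ r)) k     ≡⟨ Vec.lookup∘tabulate _ k ⟩
  residueCoeff T ((r % 2 ^ T) {{m^n≢0 2 T}}) k
    ≡⟨ cong (λ ρ → residueCoeff T ρ k) (ℕD.m<n⇒m%n≡m {{m^n≢0 2 T}} (ℕP.<-≤-trans r<h (half≤2^ T))) ⟩
  residueCoeff T r k       ≡⟨ low ⟩
  δ r k                    ∎
  where
  open ≡-Reasoning
  low : residueCoeff T r k ≡ δ r k
  low with r ℕ.≡ᵇ toℕ k
  ... | true  = refl
  ... | false with r ℕ.≡ᵇ toℕ k ℕ.+ half T in r≡k+h
  ...   | true  = ⊥-elim (ℕP.<⇒≱ r<h (subst (half T ≤_) (sym (≡ᵇ⇒≡ r≡k+h)) (ℕP.m≤n+m (half T) (toℕ k))))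
  ...   | false = refl

coeff-ζ^-high : (T : ℕ) {r : ℕ} → r < 2 ^ T → (k : Fin (2 ^ T)) →
                coeff (ζ^ (suc T) (+ (r ℕ.+ 2 ^ T))) k ≡ - δ r k
coeff-ζ^-high T {r} r<h k = begin
  coeff (ζ^ (suc T) (+ (r ℕ.+ h))) k ≡⟨ Vec.lookup∘tabulate _ k ⟩
  residueCoeff (suc T) (((r ℕ.+ h) % 2 ^ suc T) {{m^n≢0 2 (suc T)}}) k
    ≡⟨ cong (λ ρ → residueCoeff (suc T) ρ k) (ℕD.m<n⇒m%n≡m {{m^n≢0 2 (suc T)}} r+h<2h) ⟩
  residueCoeff (suc T) (r ℕ.+ h) k   ≡⟨ high ⟩
  - δ r k                            ∎
  where
  open ≡-Reasoning
  h = 2 ^ T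
  r+h<2h : r ℕ.+ h < 2 ^ suc T
  r+h<2h = ℕP.<-≤-trans (ℕP.+-monoˡ-< h r<h) (ℕP.≤-reflexive (cong (h ℕ.+_) (sym (ℕP.+-identityʳ h))))
  high : residueCoeff (suc T) (r ℕ.+ h) k ≡ - δ r k
  high with r ℕ.+ h ℕ.≡ᵇ toℕ k in r+h≡k
  ... | true = ⊥-elim (ℕP.<⇒≱ (FinP.toℕ<n k) (subst (h ≤_) (≡ᵇ⇒≡ r+h≡k) (ℕP.m≤n+m h r)))
  ... | false with r ℕ.+ h ℕ.≡ᵇ toℕ k ℕ.+ h in r+h≡k+h | r ℕ.≡ᵇ toℕ k in r≡k
  ...   | true  | true  = refl
  ...   | false | false = refl
  ...   | true  | false = ⊥-elim (≡ᵇ⇒≢ r≡k (ℕP.+-cancelʳ-≡ h r (toℕ k) (≡ᵇ⇒≡ r+h≡k+h)))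
  ...   | false | true  = ⊥-elim (≡ᵇ⇒≢ {r ℕ.+ h} {toℕ k ℕ.+ h} r+h≡k+h (cong (ℕ._+ h) (≡ᵇ⇒≡ r≡k)))

ζ^-high : (T : ℕ) {r : ℕ} → r < 2 ^ T → ζ^ (suc T) (+ (r ℕ.+ 2 ^ T)) ≡ - + 1 • ζ^ (suc T) (+ r)
ζ^-high T r<h = ≡-via-coeffs (has (coeff-ζ^-high T r<h)) (has-• (- + 1) (has (coeff-ζ^-low (suc T) r<h)))
  λ k → sym (ℤP.-1*i≡-i _)

ζ^-+half : (T : ℕ) (j : ℤ) → ζ^ (suc T) (j + + 2 ^ T) ≡ - + 1 • ζ^ (suc T) j
ζ^-+half T j = byResidue (ρ ℕ.<? h)
  where
  h = 2 ^ T
  P = 2 ^ suc T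
  ρ = (j %ℕ P) {{m^n≢0 2 (suc T)}}
  q = (j /ℕ P) {{m^n≢0 2 (suc T)}}
  j≡ρ+qP : j ≡ + ρ + q * + P
  j≡ρ+qP = a≡a%ℕn+[a/ℕn]*n j P {{m^n≢0 2 (suc T)}}
  open ≡-Reasoning
  byResidue : Dec (ρ < h) → ζ^ (suc T) (j + + h) ≡ - + 1 • ζ^ (suc T) j
  byResidue (yes ρ<h) = begin
    ζ^ (suc T) (j + + h)       ≡⟨ ζ^-cong-mod (suc T) (+ (ρ ℕ.+ h)) q j+h≡ρ+h+qP ⟩
    ζ^ (suc T) (+ (ρ ℕ.+ h))   ≡⟨ ζ^-high T ρ<h ⟩
    - + 1 • ζ^ (suc T) (+ ρ)   ≡⟨ cong (- + 1 •_) (ζ^-cong-mod (suc T) (+ ρ) q j≡ρ+qP) ⟨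
    - + 1 • ζ^ (suc T) j       ∎
    where
    shift : ∀ ρ h qP → (ρ + qP) + h ≡ (ρ + h) + qP
    shift = solve-∀
    j+h≡ρ+h+qP : j + + h ≡ + (ρ ℕ.+ h) + q * + P
    j+h≡ρ+h+qP = trans (cong (_+ + h) j≡ρ+qP) (shift (+ ρ) (+ h) (q * + P))
  byResidue (no ρ≮h) = begin
    ζ^ (suc T) (j + + h)                 ≡⟨ ζ^-cong-mod (suc T) (+ ρ') (q + + 1) j+h≡ρ'+[q+1]P ⟩
    ζ^ (suc T) (+ ρ')                    ≡⟨ •-neg-involutive _ ⟨
    - + 1 • (- + 1 • ζ^ (suc T) (+ ρ'))  ≡⟨ cong (- + 1 •_) (ζ^-high T ρ'<h) ⟨
    - + 1 • ζ^ (suc T) (+ (ρ' ℕ.+ h))    ≡⟨ cong (- + 1 •_) (ζ^-cong-mod (suc T) (+ (ρ' ℕ.+ h)) q j≡ρ'+h+qP) ⟨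
    - + 1 • ζ^ (suc T) j                 ∎
    where
    ρ' = ρ ∸ h
    ρ'+h≡ρ : ρ' ℕ.+ h ≡ ρ
    ρ'+h≡ρ = ℕP.m∸n+n≡m (ℕP.≮⇒≥ ρ≮h)
    ρ'<h : ρ' < h
    ρ'<h = ℕP.+-cancelʳ-< h ρ' h (subst (_< h ℕ.+ h) (sym ρ'+h≡ρ)
             (subst (ρ <_) (cong (h ℕ.+_) (ℕP.+-identityʳ h)) (n%ℕd<d j P {{m^n≢0 2 (suc T)}})))
    j≡ρ'+h+qP : j ≡ + (ρ' ℕ.+ h) + q * + P
    j≡ρ'+h+qP = trans j≡ρ+qP (cong (λ z → + z + q * + P) (sym ρ'+h≡ρ))
    shift : ∀ ρ' h q → ((ρ' + h) + q * (+ 2 * h)) + h ≡ ρ' + (q + + 1) * (+ 2 * h)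
    shift = solve-∀
    j+h≡ρ'+[q+1]P : j + + h ≡ + ρ' + (q + + 1) * + P
    j+h≡ρ'+[q+1]P = begin
      j + + h                                     ≡⟨ cong (_+ + h) j≡ρ'+h+qP ⟩
      (+ (ρ' ℕ.+ h) + q * + P) + + h              ≡⟨ cong (λ P → (+ (ρ' ℕ.+ h) + q * P) + + h) (ℤP.pos-* 2 h) ⟩
      ((+ ρ' + + h) + q * (+ 2 * + h)) + + h      ≡⟨ shift (+ ρ') (+ h) q ⟩
      + ρ' + (q + + 1) * (+ 2 * + h)              ≡⟨ cong (λ P → + ρ' + (q + + 1) * P) (ℤP.pos-* 2 h) ⟨
      + ρ' + (q + + 1) * + P                      ∎

ζ^-+halves : (T e : ℕ) (x : ℤ) → ζ^ (suc T) (x + + (e ℕ.* 2 ^ T)) ≡ (- + 1) ℤ.^ e • ζ^ (suc T) x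
ζ^-+halves T zero    x = trans (cong (ζ^ (suc T)) (ℤP.+-identityʳ x)) (sym (•-identityˡ _))
ζ^-+halves T (suc e) x = begin
  ζ^ (suc T) (x + (+ h + + (e ℕ.* h)))       ≡⟨ cong (ζ^ (suc T)) (reassoc x (+ h) (+ (e ℕ.* h))) ⟩
  ζ^ (suc T) ((x + + (e ℕ.* h)) + + h)       ≡⟨ ζ^-+half T (x + + (e ℕ.* h)) ⟩
  - + 1 • ζ^ (suc T) (x + + (e ℕ.* h))       ≡⟨ cong (- + 1 •_) (ζ^-+halves T e x) ⟩
  - + 1 • ((- + 1) ℤ.^ e • ζ^ (suc T) x)     ≡⟨ •-assoc (- + 1) ((- + 1) ℤ.^ e) (ζ^ (suc T) x) ⟩
  (- + 1) ℤ.^ suc e • ζ^ (suc T) x           ∎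
  where
  open ≡-Reasoning
  h = 2 ^ T
  reassoc : ∀ x h eh → x + (h + eh) ≡ (x + eh) + h
  reassoc = solve-∀

record HalfDecomposition (T : ℕ) (j : ℤ) : Set where
  constructor decomposition
  field
    residue   : ℕ
    halves    : ℕ
    periods   : ℤ
    residue<  : residue < 2 ^ T
    exponent≡ : j ≡ (+ residue + + (halves ℕ.* 2 ^ T)) + periods * + 2 ^ suc T

halfDecomposition : (T : ℕ) (j : ℤ) → HalfDecomposition T j
halfDecomposition T j = decomposition ((ρ % h) {{m^n≢0 2 T}}) ((ρ / h) {{m^n≢0 2 T}}) q (ℕD.m%n<n ρ h {{m^n≢0 2 T}})
  (trans (a≡a%ℕn+[a/ℕn]*n j (2 ^ suc T) {{m^n≢0 2 (suc T)}})
         (cong (λ r → + r + q * + 2 ^ suc T) (ℕD.m≡m%n+[m/n]*n ρ h {{m^n≢0 2 T}})))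
  where
  h = 2 ^ T
  ρ = (j %ℕ 2 ^ suc T) {{m^n≢0 2 (suc T)}}
  q = (j /ℕ 2 ^ suc T) {{m^n≢0 2 (suc T)}}

ζ^-split : (T e : ℕ) (x k : ℤ) → ζ^ (suc T) ((x + + (e ℕ.* 2 ^ T)) + k * + 2 ^ suc T) ≡ (- + 1) ℤ.^ e • ζ^ (suc T) x
ζ^-split T e x k = trans (ζ^-cong-mod (suc T) (x + + (e ℕ.* 2 ^ T)) k refl) (ζ^-+halves T e x)

ζ^-+half-multiple : (T e : ℕ) (x b : ℤ) {a : ℤ} → a ≡ + e + b * + 2 → ζ^ (suc T) (x + + 2 ^ T * a) ≡ (- + 1) ℤ.^ e • ζ^ (suc T) x
ζ^-+half-multiple T e x b {a} a≡e+2b = trans (cong (ζ^ (suc T)) exponent) (ζ^-split T e x b)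
  where
  open ≡-Reasoning
  regroup : ∀ x h e b → x + h * (e + b * + 2) ≡ (x + e * h) + b * (+ 2 * h)
  regroup = solve-∀
  exponent : x + + 2 ^ T * a ≡ (x + + (e ℕ.* 2 ^ T)) + b * + 2 ^ suc T
  exponent = begin
    x + + 2 ^ T * a                            ≡⟨ cong (λ a → x + + 2 ^ T * a) a≡e+2b ⟩
    x + + 2 ^ T * (+ e + b * + 2)              ≡⟨ regroup x (+ 2 ^ T) (+ e) b ⟩
    (x + + e * + 2 ^ T) + b * (+ 2 * + 2 ^ T)  ≡⟨ cong₂ (λ eh P → (x + eh) + b * P) (ℤP.pos-* e (2 ^ T)) (ℤP.pos-* 2 (2 ^ T)) ⟨
    (x + + (e ℕ.* 2 ^ T)) + b * + 2 ^ suc T    ∎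

ζ^-neg-half-multiple : (T e : ℕ) → ζ^ (suc T) (- + (e ℕ.* 2 ^ T)) ≡ (- + 1) ℤ.^ e • oneC (suc T)
ζ^-neg-half-multiple T e = trans (cong (ζ^ (suc T)) exponent) (ζ^-split T e (+ 0) (- + e))
  where
  shift : ∀ e h → - (e * h) ≡ (+ 0 + e * h) + - e * (+ 2 * h)
  shift = solve-∀
  exponent : - + (e ℕ.* 2 ^ T) ≡ (+ 0 + + (e ℕ.* 2 ^ T)) + - + e * + 2 ^ suc T
  exponent = begin
    - + (e ℕ.* 2 ^ T)                               ≡⟨ cong -_ (ℤP.pos-* e (2 ^ T)) ⟩
    - (+ e * + 2 ^ T)                               ≡⟨ shift (+ e) (+ 2 ^ T) ⟩
    (+ 0 + + e * + 2 ^ T) + - + e * (+ 2 * + 2 ^ T) ≡⟨ cong₂ (λ eh P → (+ 0 + eh) + - + e * P) (ℤP.pos-* e (2 ^ T)) (ℤP.pos-* 2 (2 ^ T)) ⟨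
    (+ 0 + + (e ℕ.* 2 ^ T)) + - + e * + 2 ^ suc T   ∎
    where open ≡-Reasoning

module _ {T : ℕ} {j : ℤ} (d : HalfDecomposition T j) where
  open HalfDecomposition d

  ζ^-decomposed : (x : ℤ) → ζ^ (suc T) (j + x) ≡ (- + 1) ℤ.^ halves • ζ^ (suc T) (+ residue + x)
  ζ^-decomposed x = trans (cong (ζ^ (suc T)) (trans (cong (_+ x) exponent≡) (reassoc (+ residue) _ _ x)))
                          (ζ^-split T halves (+ residue + x) periods)
    where reassoc : ∀ r eh kP x → ((r + eh) + kP) + x ≡ ((r + x) + eh) + kP
          reassoc = solve-∀

  ζ^-residue : ζ^ (suc T) j ≡ (- + 1) ℤ.^ halves • ζ^ (suc T) (+ residue)
  ζ^-residue = begin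
    ζ^ (suc T) j                                   ≡⟨ cong (ζ^ (suc T)) (ℤP.+-identityʳ j) ⟨
    ζ^ (suc T) (j + + 0)                           ≡⟨ ζ^-decomposed (+ 0) ⟩
    (- + 1) ℤ.^ halves • ζ^ (suc T) (+ residue + + 0) ≡⟨ cong (λ x → (- + 1) ℤ.^ halves • ζ^ (suc T) x) (ℤP.+-identityʳ (+ residue)) ⟩
    (- + 1) ℤ.^ halves • ζ^ (suc T) (+ residue)    ∎
    where open ≡-Reasoning

-- Multiplication

module _ {T : ℕ} where

  ζ^[i+j] : Fin (half T) → Fin (half T) → Cyc T
  ζ^[i+j] i j = ζ^ T (+ (toℕ i ℕ.+ toℕ j))

  ⊗-term : Cyc T → Cyc T → Fin (half T) → Fin (half T) → Cyc T
  ⊗-term u v i j = (coeff u i * coeff v j) • ζ^[i+j] i j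

  ⊗≡∑∑ : (u v : Cyc T) → u ⊗ v ≡ ∑[ i ← allFin (half T) ] ∑[ j ← allFin (half T) ] ⊗-term u v i j
  ⊗≡∑∑ u v = trans (foldr≡∑ (allFin _) _) (∑-cong (allFin _) λ i → foldr≡∑ (allFin _) (⊗-term u v i))

  private
    ⊗-via-terms-• : (c : ℤ) (u′ v′ u v : Cyc T) →
                   (∀ i j → ⊗-term u′ v′ i j ≡ c • ⊗-term u v i j) → u′ ⊗ v′ ≡ c • (u ⊗ v)
    ⊗-via-terms-• c u′ v′ u v F≡cG = begin
      u′ ⊗ v′                                                    ≡⟨ ⊗≡∑∑ u′ v′ ⟩
      ∑[ i ← allFin _ ] ∑[ j ← allFin _ ] ⊗-term u′ v′ i j        ≡⟨ ∑-cong (allFin _) (λ i → ∑-cong (allFin _) (F≡cG i)) ⟩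
      ∑[ i ← allFin _ ] ∑[ j ← allFin _ ] (c • ⊗-term u v i j)    ≡⟨ ∑-cong (allFin _) (λ i → •-distrib-∑ c (allFin _) (⊗-term u v i)) ⟨
      ∑[ i ← allFin _ ] (c • ∑[ j ← allFin _ ] ⊗-term u v i j)    ≡⟨ •-distrib-∑ c (allFin _) _ ⟨
      c • ∑[ i ← allFin _ ] ∑[ j ← allFin _ ] ⊗-term u v i j      ≡⟨ cong (c •_) (⊗≡∑∑ u v) ⟨
      c • (u ⊗ v)                                                ∎
      where open ≡-Reasoning

    ⊗-via-terms-⊕ : (u v u₁ v₁ u₂ v₂ : Cyc T) →
                   (∀ i j → ⊗-term u v i j ≡ ⊗-term u₁ v₁ i j ⊕ ⊗-term u₂ v₂ i j) → u ⊗ v ≡ u₁ ⊗ v₁ ⊕ u₂ ⊗ v₂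
    ⊗-via-terms-⊕ u v u₁ v₁ u₂ v₂ F≡G⊕H = begin
      u ⊗ v                                                     ≡⟨ ⊗≡∑∑ u v ⟩
      ∑[ i ← allFin _ ] ∑[ j ← allFin _ ] ⊗-term u v i j         ≡⟨ ∑-cong (allFin _) (λ i → ∑-cong (allFin _) (F≡G⊕H i)) ⟩
      ∑[ i ← allFin _ ] ∑[ j ← allFin _ ] (⊗-term u₁ v₁ i j ⊕ ⊗-term u₂ v₂ i j)
        ≡⟨ ∑-cong (allFin _) (λ i → ∑-distrib-⊕ (allFin _) (⊗-term u₁ v₁ i) (⊗-term u₂ v₂ i)) ⟩
      ∑[ i ← allFin _ ] (∑ (allFin _) (⊗-term u₁ v₁ i) ⊕ ∑ (allFin _) (⊗-term u₂ v₂ i))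
        ≡⟨ ∑-distrib-⊕ (allFin _) _ _ ⟩
      (∑[ i ← allFin _ ] ∑[ j ← allFin _ ] ⊗-term u₁ v₁ i j) ⊕ (∑[ i ← allFin _ ] ∑[ j ← allFin _ ] ⊗-term u₂ v₂ i j)
        ≡⟨ cong₂ _⊕_ (⊗≡∑∑ u₁ v₁) (⊗≡∑∑ u₂ v₂) ⟨
      u₁ ⊗ v₁ ⊕ u₂ ⊗ v₂                                         ∎
      where open ≡-Reasoning

  ⊗-•ˡ : (c : ℤ) (u v : Cyc T) → (c • u) ⊗ v ≡ c • (u ⊗ v)
  ⊗-•ˡ c u v = ⊗-via-terms-• c (c • u) v u v λ i j → begin
    (coeff (c • u) i * coeff v j) • ζ^[i+j] i j ≡⟨ cong (λ a → (a * coeff v j) • ζ^[i+j] i j) (coeff≡ (has-• c (has-coeff u)) i) ⟩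
    (c * coeff u i * coeff v j) • ζ^[i+j] i j   ≡⟨ cong (_• ζ^[i+j] i j) (ℤP.*-assoc c (coeff u i) (coeff v j)) ⟩
    (c * (coeff u i * coeff v j)) • ζ^[i+j] i j ≡⟨ •-assoc c (coeff u i * coeff v j) (ζ^[i+j] i j) ⟨
    c • ⊗-term u v i j                          ∎
    where open ≡-Reasoning

  ⊗-•ʳ : (c : ℤ) (u v : Cyc T) → u ⊗ (c • v) ≡ c • (u ⊗ v)
  ⊗-•ʳ c u v = ⊗-via-terms-• c u (c • v) u v λ i j → begin
    (coeff u i * coeff (c • v) j) • ζ^[i+j] i j ≡⟨ cong (λ b → (coeff u i * b) • ζ^[i+j] i j) (coeff≡ (has-• c (has-coeff v)) j) ⟩
    (coeff u i * (c * coeff v j)) • ζ^[i+j] i j ≡⟨ cong (_• ζ^[i+j] i j) (swap (coeff u i) c (coeff v j)) ⟩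
    (c * (coeff u i * coeff v j)) • ζ^[i+j] i j ≡⟨ •-assoc c (coeff u i * coeff v j) (ζ^[i+j] i j) ⟨
    c • ⊗-term u v i j                          ∎
    where
    open ≡-Reasoning
    swap : ∀ a c b → a * (c * b) ≡ c * (a * b)
    swap = solve-∀

  ⊗-distribˡ-⊕ : (u v w : Cyc T) → u ⊗ (v ⊕ w) ≡ u ⊗ v ⊕ u ⊗ w
  ⊗-distribˡ-⊕ u v w = ⊗-via-terms-⊕ u (v ⊕ w) u v u w λ i j → begin
    (coeff u i * coeff (v ⊕ w) j) • ζ^[i+j] i j
      ≡⟨ cong (λ b → (coeff u i * b) • ζ^[i+j] i j) (coeff≡ (has-⊕ (has-coeff v) (has-coeff w)) j) ⟩
    (coeff u i * (coeff v j + coeff w j)) • ζ^[i+j] i j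
      ≡⟨ cong (_• ζ^[i+j] i j) (ℤP.*-distribˡ-+ (coeff u i) (coeff v j) (coeff w j)) ⟩
    (coeff u i * coeff v j + coeff u i * coeff w j) • ζ^[i+j] i j
      ≡⟨ •-distribʳ-+ (coeff u i * coeff v j) (coeff u i * coeff w j) (ζ^[i+j] i j) ⟩
    ⊗-term u v i j ⊕ ⊗-term u w i j ∎
    where open ≡-Reasoning

  ⊗-distribʳ-⊕ : (u v w : Cyc T) → (u ⊕ v) ⊗ w ≡ u ⊗ w ⊕ v ⊗ w
  ⊗-distribʳ-⊕ u v w = ⊗-via-terms-⊕ (u ⊕ v) w u w v w λ i j → begin
    (coeff (u ⊕ v) i * coeff w j) • ζ^[i+j] i j
      ≡⟨ cong (λ a → (a * coeff w j) • ζ^[i+j] i j) (coeff≡ (has-⊕ (has-coeff u) (has-coeff v)) i) ⟩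
    ((coeff u i + coeff v i) * coeff w j) • ζ^[i+j] i j
      ≡⟨ cong (_• ζ^[i+j] i j) (ℤP.*-distribʳ-+ (coeff w j) (coeff u i) (coeff v i)) ⟩
    (coeff u i * coeff w j + coeff v i * coeff w j) • ζ^[i+j] i j
      ≡⟨ •-distribʳ-+ (coeff u i * coeff w j) (coeff v i * coeff w j) (ζ^[i+j] i j) ⟩
    ⊗-term u w i j ⊕ ⊗-term v w i j ∎
    where open ≡-Reasoning

ζ^⊗ζ^-low : (T : ℕ) {r₁ r₂ : ℕ} → r₁ < half T → r₂ < half T →
           ζ^ T (+ r₁) ⊗ ζ^ T (+ r₂) ≡ ζ^ T (+ (r₁ ℕ.+ r₂))
ζ^⊗ζ^-low T {r₁} {r₂} r₁<h r₂<h = begin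
  ζ^ T (+ r₁) ⊗ ζ^ T (+ r₂)
    ≡⟨ ⊗≡∑∑ (ζ^ T (+ r₁)) (ζ^ T (+ r₂)) ⟩
  ∑[ i ← allFin (half T) ] ∑[ j ← allFin (half T) ] ⊗-term (ζ^ T (+ r₁)) (ζ^ T (+ r₂)) i j
    ≡⟨ ∑-cong (allFin _) (λ i → ∑-cong (allFin _) (term i)) ⟩
  ∑[ i ← allFin (half T) ] ∑[ j ← allFin (half T) ] (δ r₁ i • (δ r₂ j • ζ^[i+j] i j))
    ≡⟨ ∑-cong (allFin _) (λ i → •-distrib-∑ (δ r₁ i) (allFin _) (λ j → δ r₂ j • ζ^[i+j] i j)) ⟨
  ∑[ i ← allFin (half T) ] (δ r₁ i • ∑[ j ← allFin (half T) ] (δ r₂ j • ζ^[i+j] i j))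
    ≡⟨ ∑-cong (allFin _) (λ i → cong (δ r₁ i •_) (∑-δ r₂<h λ j → ζ^ T (+ (toℕ i ℕ.+ j)))) ⟩
  ∑[ i ← allFin (half T) ] (δ r₁ i • ζ^ T (+ (toℕ i ℕ.+ r₂)))
    ≡⟨ ∑-δ r₁<h (λ i → ζ^ T (+ (i ℕ.+ r₂))) ⟩
  ζ^ T (+ (r₁ ℕ.+ r₂)) ∎
  where
  open ≡-Reasoning
  term : ∀ i j → (coeff (ζ^ T (+ r₁)) i * coeff (ζ^ T (+ r₂)) j) • ζ^[i+j] i j ≡ δ r₁ i • (δ r₂ j • ζ^[i+j] i j)
  term i j = trans (cong₂ (λ a b → (a * b) • ζ^[i+j] i j) (coeff-ζ^-low T r₁<h i) (coeff-ζ^-low T r₂<h j))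
                   (sym (•-assoc (δ r₁ i) (δ r₂ j) (ζ^[i+j] i j)))

ζ^⊗ζ^ : (T : ℕ) (a b : ℤ) → ζ^ (suc T) a ⊗ ζ^ (suc T) b ≡ ζ^ (suc T) (a + b)
ζ^⊗ζ^ T a b = begin
  ζ^ (suc T) a ⊗ ζ^ (suc T) b                       ≡⟨ cong₂ _⊗_ (ζ^-residue da) (ζ^-residue db) ⟩
  (sa • ζ^ (suc T) (+ ra)) ⊗ (sb • ζ^ (suc T) (+ rb)) ≡⟨ ⊗-•ˡ sa (ζ^ (suc T) (+ ra)) (sb • ζ^ (suc T) (+ rb)) ⟩
  sa • (ζ^ (suc T) (+ ra) ⊗ (sb • ζ^ (suc T) (+ rb))) ≡⟨ cong (sa •_) (⊗-•ʳ sb (ζ^ (suc T) (+ ra)) (ζ^ (suc T) (+ rb))) ⟩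
  sa • (sb • (ζ^ (suc T) (+ ra) ⊗ ζ^ (suc T) (+ rb))) ≡⟨ cong (λ u → sa • (sb • u)) (ζ^⊗ζ^-low (suc T) (HalfDecomposition.residue< da) (HalfDecomposition.residue< db)) ⟩
  sa • (sb • ζ^ (suc T) (+ (ra ℕ.+ rb)))              ≡⟨ cong (λ r → sa • (sb • ζ^ (suc T) (+ r))) (ℕP.+-comm ra rb) ⟩
  sa • (sb • ζ^ (suc T) (+ rb + + ra))                ≡⟨ cong (sa •_) (ζ^-decomposed db (+ ra)) ⟨
  sa • ζ^ (suc T) (b + + ra)                          ≡⟨ cong (λ x → sa • ζ^ (suc T) x) (ℤP.+-comm b (+ ra)) ⟩
  sa • ζ^ (suc T) (+ ra + b)                          ≡⟨ ζ^-decomposed da b ⟨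
  ζ^ (suc T) (a + b)                                  ∎
  where
  open ≡-Reasoning
  da = halfDecomposition T a
  db = halfDecomposition T b
  ra = HalfDecomposition.residue da
  rb = HalfDecomposition.residue db
  sa = (- + 1) ℤ.^ HalfDecomposition.halves da
  sb = (- + 1) ℤ.^ HalfDecomposition.halves db

ζ^⊗oneC : (T : ℕ) (a : ℤ) → ζ^ (suc T) a ⊗ oneC (suc T) ≡ ζ^ (suc T) a
ζ^⊗oneC T a = trans (ζ^⊗ζ^ T a (+ 0)) (cong (ζ^ (suc T)) (ℤP.+-identityʳ a))

iC^ : (T x : ℕ) → iC (suc T) ^C x ≡ ζ^ (suc T) (+ (x ℕ.* 2 ^ (suc T ∸ 2)))
iC^ T zero    = refl
iC^ T (suc x) = trans (cong (iC (suc T) ⊗_) (iC^ T x)) (ζ^⊗ζ^ T (+ 2 ^ (suc T ∸ 2)) (+ (x ℕ.* 2 ^ (suc T ∸ 2))))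

sqrt2-⊗ : (T : ℕ) (c : ℤ) → sqrt2 (suc T) ⊗ (oneC (suc T) ⊕ c • oneC (suc T)) ≡ (+ 1 + c) • sqrt2 (suc T)
sqrt2-⊗ T c = begin
  √2 ⊗ (oneC (suc T) ⊕ c • oneC (suc T))       ≡⟨ ⊗-distribˡ-⊕ √2 (oneC (suc T)) (c • oneC (suc T)) ⟩
  √2 ⊗ oneC (suc T) ⊕ √2 ⊗ (c • oneC (suc T))  ≡⟨ cong (√2 ⊗ oneC (suc T) ⊕_) (⊗-•ʳ c √2 (oneC (suc T))) ⟩
  √2 ⊗ oneC (suc T) ⊕ c • (√2 ⊗ oneC (suc T))  ≡⟨ cong (λ u → u ⊕ c • u) √2⊗1≡√2 ⟩
  √2 ⊕ c • √2                                  ≡⟨ cong (_⊕ c • √2) (•-identityˡ √2) ⟨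
  + 1 • √2 ⊕ c • √2                            ≡⟨ •-distribʳ-+ (+ 1) c √2 ⟨
  (+ 1 + c) • √2                               ∎
  where
  open ≡-Reasoning
  √2 = sqrt2 (suc T)
  ε = + 2 ^ (suc T ∸ 3)
  √2⊗1≡√2 : √2 ⊗ oneC (suc T) ≡ √2
  √2⊗1≡√2 = trans (⊗-distribʳ-⊕ (ζ^ (suc T) ε) (ζ^ (suc T) (- ε)) (oneC (suc T)))
                  (cong₂ _⊕_ (ζ^⊗oneC T ε) (ζ^⊗oneC T (- ε)))

-- Geometric sums over roots of unity

+2^-+ : (a b : ℕ) → + 2 ^ (a ℕ.+ b) ≡ + 2 ^ a * + 2 ^ b
+2^-+ a b = trans (cong +_ (ℕP.^-distribˡ-+-* 2 a b)) (ℤP.pos-* (2 ^ a) (2 ^ b))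

geomSum : (T s j : ℕ) (c a : ℤ) → Cyc T
geomSum T s j c a = ∑[ y ← upTo (2 ^ j) ] ζ^ T (c + + y * (+ 2 ^ s * a))

geomSum-full : (T s j : ℕ) (c a : ℤ) → s ℕ.+ j ≡ T → + 2 ^ j ∣ℤ a → geomSum T s j c a ≡ + 2 ^ j • ζ^ T c
geomSum-full T s j c a s+j≡T (divides k a≡kJ) = begin
  ∑[ y ← upTo (2 ^ j) ] ζ^ T (c + + y * (+ 2 ^ s * a)) ≡⟨ ∑-cong (upTo (2 ^ j)) (λ y → ζ^-cong-mod T c (+ y * k) (period y)) ⟩
  ∑[ y ← upTo (2 ^ j) ] ζ^ T c                         ≡⟨ ∑-const (upTo (2 ^ j)) (ζ^ T c) ⟩
  + length (upTo (2 ^ j)) • ζ^ T c                     ≡⟨ cong (λ n → + n • ζ^ T c) (List.length-upTo (2 ^ j)) ⟩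
  + 2 ^ j • ζ^ T c                                     ∎
  where
  open ≡-Reasoning
  regroup : ∀ c y S k J → c + y * (S * (k * J)) ≡ c + (y * k) * (S * J)
  regroup = solve-∀
  period : ∀ y → c + + y * (+ 2 ^ s * a) ≡ c + (+ y * k) * + 2 ^ T
  period y = begin
    c + + y * (+ 2 ^ s * a)              ≡⟨ cong (λ a → c + + y * (+ 2 ^ s * a)) a≡kJ ⟩
    c + + y * (+ 2 ^ s * (k * + 2 ^ j))  ≡⟨ regroup c (+ y) (+ 2 ^ s) k (+ 2 ^ j) ⟩
    c + (+ y * k) * (+ 2 ^ s * + 2 ^ j)  ≡⟨ cong (λ P → c + (+ y * k) * P) (trans (sym (+2^-+ s j)) (cong (λ t → + 2 ^ t) s+j≡T)) ⟩
    c + (+ y * k) * + 2 ^ T              ∎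

geomSum-halves : (s j : ℕ) (c a : ℤ) →
                 geomSum (suc (s ℕ.+ j)) s (suc j) c a
                 ≡ geomSum (suc (s ℕ.+ j)) s j c a ⊕ geomSum (suc (s ℕ.+ j)) s j (c + + 2 ^ (s ℕ.+ j) * a) a
geomSum-halves s j c a = begin
  ∑ (upTo (2 ^ j ℕ.+ (2 ^ j ℕ.+ 0))) f
    ≡⟨ ∑-upTo-+ (2 ^ j) (2 ^ j ℕ.+ 0) f ⟩
  ∑ (upTo (2 ^ j)) f ⊕ ∑[ y ← upTo (2 ^ j ℕ.+ 0) ] f (2 ^ j ℕ.+ y)
    ≡⟨ cong (λ n → ∑ (upTo (2 ^ j)) f ⊕ ∑[ y ← upTo n ] f (2 ^ j ℕ.+ y)) (ℕP.+-identityʳ (2 ^ j)) ⟩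
  ∑ (upTo (2 ^ j)) f ⊕ ∑[ y ← upTo (2 ^ j) ] f (2 ^ j ℕ.+ y)
    ≡⟨ cong (∑ (upTo (2 ^ j)) f ⊕_) (∑-cong (upTo (2 ^ j)) λ y → cong (ζ^ (suc (s ℕ.+ j))) (upper y)) ⟩
  ∑ (upTo (2 ^ j)) f ⊕ geomSum (suc (s ℕ.+ j)) s j (c + + 2 ^ (s ℕ.+ j) * a) a ∎
  where
  open ≡-Reasoning
  f : ℕ → Cyc (suc (s ℕ.+ j))
  f y = ζ^ (suc (s ℕ.+ j)) (c + + y * (+ 2 ^ s * a))
  regroup : ∀ c y J S a → c + (J + y) * (S * a) ≡ (c + S * J * a) + y * (S * a)
  regroup = solve-∀
  upper : ∀ y → c + + (2 ^ j ℕ.+ y) * (+ 2 ^ s * a) ≡ (c + + 2 ^ (s ℕ.+ j) * a) + + y * (+ 2 ^ s * a)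
  upper y = trans (regroup c (+ y) (+ 2 ^ j) (+ 2 ^ s) a) (cong (λ H → (c + H * a) + + y * (+ 2 ^ s * a)) (sym (+2^-+ s j)))

geomSum-shift : (T s j : ℕ) (c d a w : ℤ) → (∀ x → ζ^ T (x + d) ≡ w • ζ^ T x) →
                geomSum T s j (c + d) a ≡ w • geomSum T s j c a
geomSum-shift T s j c d a w shift = begin
  ∑[ y ← upTo (2 ^ j) ] ζ^ T ((c + d) + + y * (+ 2 ^ s * a))  ≡⟨ ∑-cong (upTo (2 ^ j)) (λ y → trans (cong (ζ^ T) (swap c d (+ y * (+ 2 ^ s * a)))) (shift (c + + y * (+ 2 ^ s * a)))) ⟩
  ∑[ y ← upTo (2 ^ j) ] (w • ζ^ T (c + + y * (+ 2 ^ s * a)))  ≡⟨ •-distrib-∑ w (upTo (2 ^ j)) _ ⟨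
  w • geomSum T s j c a                                       ∎
  where
  open ≡-Reasoning
  swap : ∀ c d x → (c + d) + x ≡ (c + x) + d
  swap = solve-∀

geomSum-double : (T s j : ℕ) (c b : ℤ) → geomSum T s j c (b * + 2) ≡ geomSum T (suc s) j c b
geomSum-double T s j c b = ∑-cong (upTo (2 ^ j)) λ y →
  cong (λ S → ζ^ T (c + + y * S)) (trans (regroup (+ 2 ^ s) b) (cong (_* b) (sym (ℤP.pos-* 2 (2 ^ s)))))
  where regroup : ∀ S b → S * (b * + 2) ≡ (+ 2 * S) * b
        regroup = solve-∀

-- For odd a the two halves of the sum cancel; for even a = 2b they agree, and each is
-- the sum for b over half as many roots.
geomSum-vanishes : (T s j : ℕ) (c a : ℤ) → s ℕ.+ j ≡ T → ¬ (+ 2 ^ j ∣ℤ a) → geomSum T s j c a ≡ zeroC T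
geomSum-vanishes T s zero    c a _ 1∤a = ⊥-elim (1∤a (divides a (sym (ℤP.*-identityʳ a))))
geomSum-vanishes T s (suc j) c a s+j≡T 2^[1+j]∤a with trans (sym (ℕP.+-suc s j)) s+j≡T
... | refl = begin
  geomSum T s (suc j) c a                ≡⟨ geomSum-halves s j c a ⟩
  G c ⊕ G (c + + 2 ^ (s ℕ.+ j) * a)      ≡⟨ cong (G c ⊕_) (geomSum-shift T s j c (+ 2 ^ (s ℕ.+ j) * a) a ((- + 1) ℤ.^ ε) (λ x → ζ^-+half-multiple (s ℕ.+ j) ε x b a≡ε+2b)) ⟩
  G c ⊕ (- + 1) ℤ.^ ε • G c              ≡⟨ by-parity ε (n%ℕd<d a 2) a≡ε+2b ⟩
  zeroC T                                ∎
  where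
  open ≡-Reasoning
  G : ℤ → Cyc T
  G c = geomSum T s j c a
  ε = a %ℕ 2
  b = a /ℕ 2
  a≡ε+2b : a ≡ + ε + b * + 2
  a≡ε+2b = a≡a%ℕn+[a/ℕn]*n a 2
  by-parity : ∀ e → e < 2 → a ≡ + e + b * + 2 → G c ⊕ (- + 1) ℤ.^ e • G c ≡ zeroC T
  by-parity 0 _ a≡0+2b = begin
    G c ⊕ + 1 • G c         ≡⟨ cong (λ u → u ⊕ + 1 • u) G≡0 ⟩
    zeroC T ⊕ + 1 • zeroC T ≡⟨ trans (⊕-identityˡ _) (•-zeroʳ (+ 1)) ⟩
    zeroC T                 ∎
    where
    a≡2b : a ≡ b * + 2
    a≡2b = trans a≡0+2b (ℤP.+-identityˡ _)
    reassoc : ∀ k J → k * J * + 2 ≡ k * (+ 2 * J)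
    reassoc = solve-∀
    2^j∤b : ¬ (+ 2 ^ j ∣ℤ b)
    2^j∤b (divides k b≡k2^j) = 2^[1+j]∤a (divides k (begin
      a                       ≡⟨ a≡2b ⟩
      b * + 2                 ≡⟨ cong (_* + 2) b≡k2^j ⟩
      k * + 2 ^ j * + 2       ≡⟨ reassoc k (+ 2 ^ j) ⟩
      k * (+ 2 * + 2 ^ j)     ≡⟨ cong (k *_) (ℤP.pos-* 2 (2 ^ j)) ⟨
      k * + 2 ^ suc j         ∎))
    G≡0 : G c ≡ zeroC T
    G≡0 = trans (cong (geomSum T s j c) a≡2b) (trans (geomSum-double T s j c b) (geomSum-vanishes T (suc s) j c b refl 2^j∤b))
  by-parity 1 _ _ = ⊕-cancel-neg (G c)
  by-parity (suc (suc _)) (s≤s (s≤s ())) _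

-- Folding S along the period of the weight

S-summand : (T x m : ℕ) → e (suc T) x m ⊗ (oneC (suc T) ⊕ iC (suc T) ^C x)
                          ≡ ζ^ (suc T) (+ x * - + m) ⊕ ζ^ (suc T) (+ x * (+ 2 ^ (suc T ∸ 2) - + m))
S-summand T x m = begin
  ζ^ T′ (- + (x ℕ.* m)) ⊗ (ζ^ T′ (+ 0) ⊕ iC T′ ^C x)
    ≡⟨ ⊗-distribˡ-⊕ (ζ^ T′ (- + (x ℕ.* m))) (ζ^ T′ (+ 0)) (iC T′ ^C x) ⟩
  ζ^ T′ (- + (x ℕ.* m)) ⊗ ζ^ T′ (+ 0) ⊕ ζ^ T′ (- + (x ℕ.* m)) ⊗ iC T′ ^C x
    ≡⟨ cong₂ _⊕_ (ζ^⊗ζ^ T (- + (x ℕ.* m)) (+ 0)) (trans (cong (ζ^ T′ (- + (x ℕ.* m)) ⊗_) (iC^ T x)) (ζ^⊗ζ^ T (- + (x ℕ.* m)) (+ (x ℕ.* q)))) ⟩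
  ζ^ T′ (- + (x ℕ.* m) + + 0) ⊕ ζ^ T′ (- + (x ℕ.* m) + + (x ℕ.* q))
    ≡⟨ cong₂ (λ xm xq → ζ^ T′ (- xm + + 0) ⊕ ζ^ T′ (- xm + xq)) (ℤP.pos-* x m) (ℤP.pos-* x q) ⟩
  ζ^ T′ (- (+ x * + m) + + 0) ⊕ ζ^ T′ (- (+ x * + m) + + x * + q)
    ≡⟨ cong₂ (λ u v → ζ^ T′ u ⊕ ζ^ T′ v) (factor₁ (+ x) (+ m)) (factor₂ (+ x) (+ m) (+ q)) ⟩
  ζ^ T′ (+ x * - + m) ⊕ ζ^ T′ (+ x * (+ q - + m)) ∎
  where
  open ≡-Reasoning
  T′ = suc T
  q = 2 ^ (suc T ∸ 2)
  factor₁ : ∀ x m → - (x * m) + + 0 ≡ x * - m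
  factor₁ = solve-∀
  factor₂ : ∀ x m q → - (x * m) + x * q ≡ x * (q - m)
  factor₂ = solve-∀

S-fold : (T s j m : ℕ) → s ℕ.+ j ≡ suc T →
         (∀ y r → kron2 (y ℕ.* 2 ^ s ℕ.+ r) ℤ.^ suc T ≡ kron2 r ℤ.^ suc T) →
         let a = - + m
             b = + 2 ^ (suc T ∸ 2) - + m
         in S (suc T) m ≡ ∑[ r ← upTo (2 ^ s) ]
                            (kron2 r ℤ.^ suc T • (geomSum (suc T) s j (+ r * a) a ⊕ geomSum (suc T) s j (+ r * b) b))
S-fold T s j m s+j≡T χ-periodic = begin
  S T′ m
    ≡⟨ foldr≡∑ (upTo (2 ^ T′)) F ⟩
  ∑ (upTo (2 ^ T′)) F
    ≡⟨ cong (λ n → ∑ (upTo n) F) 2^T≡2^j*2^s ⟩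
  ∑ (upTo (2 ^ j ℕ.* 2 ^ s)) F
    ≡⟨ ∑-upTo-* (2 ^ j) (2 ^ s) F ⟩
  ∑[ y ← upTo (2 ^ j) ] ∑[ r ← upTo (2 ^ s) ] F (y ℕ.* 2 ^ s ℕ.+ r)
    ≡⟨ ∑-comm (upTo (2 ^ j)) (upTo (2 ^ s)) (λ y r → F (y ℕ.* 2 ^ s ℕ.+ r)) ⟩
  ∑[ r ← upTo (2 ^ s) ] ∑[ y ← upTo (2 ^ j) ] F (y ℕ.* 2 ^ s ℕ.+ r)
    ≡⟨ ∑-cong (upTo (2 ^ s)) fold-block ⟩
  ∑[ r ← upTo (2 ^ s) ] (χ r • (geomSum T′ s j (+ r * a) a ⊕ geomSum T′ s j (+ r * b) b)) ∎
  where
  open ≡-Reasoning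
  T′ = suc T
  a = - + m
  b = + 2 ^ (suc T ∸ 2) - + m
  χ : ℕ → ℤ
  χ r = kron2 r ℤ.^ T′
  F : ℕ → Cyc T′
  F x = χ x • (e T′ x m ⊗ (oneC T′ ⊕ iC T′ ^C x))
  2^T≡2^j*2^s : 2 ^ T′ ≡ 2 ^ j ℕ.* 2 ^ s
  2^T≡2^j*2^s = trans (cong (2 ^_) (sym s+j≡T)) (trans (ℕP.^-distribˡ-+-* 2 s j) (ℕP.*-comm (2 ^ s) (2 ^ j)))
  split : ∀ y s r a → (y * s + r) * a ≡ r * a + y * (s * a)
  split = solve-∀
  exponent : ∀ y r a → + (y ℕ.* 2 ^ s ℕ.+ r) * a ≡ + r * a + + y * (+ 2 ^ s * a)
  exponent y r a = trans (cong (λ ys → (ys + + r) * a) (ℤP.pos-* y (2 ^ s))) (split (+ y) (+ 2 ^ s) (+ r) a)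
  unfold-term : ∀ r y → F (y ℕ.* 2 ^ s ℕ.+ r) ≡ χ r • (ζ^ T′ (+ r * a + + y * (+ 2 ^ s * a)) ⊕ ζ^ T′ (+ r * b + + y * (+ 2 ^ s * b)))
  unfold-term r y = cong₂ _•_ (χ-periodic y r)
    (trans (S-summand T (y ℕ.* 2 ^ s ℕ.+ r) m) (cong₂ (λ u v → ζ^ T′ u ⊕ ζ^ T′ v) (exponent y r a) (exponent y r b)))
  fold-block : ∀ r → ∑[ y ← upTo (2 ^ j) ] F (y ℕ.* 2 ^ s ℕ.+ r)
                     ≡ χ r • (geomSum T′ s j (+ r * a) a ⊕ geomSum T′ s j (+ r * b) b)
  fold-block r = begin
    ∑[ y ← upTo (2 ^ j) ] F (y ℕ.* 2 ^ s ℕ.+ r)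
      ≡⟨ ∑-cong (upTo (2 ^ j)) (unfold-term r) ⟩
    ∑[ y ← upTo (2 ^ j) ] (χ r • (ζ^ T′ (+ r * a + + y * (+ 2 ^ s * a)) ⊕ ζ^ T′ (+ r * b + + y * (+ 2 ^ s * b))))
      ≡⟨ •-distrib-∑ (χ r) (upTo (2 ^ j)) _ ⟨
    χ r • ∑[ y ← upTo (2 ^ j) ] (ζ^ T′ (+ r * a + + y * (+ 2 ^ s * a)) ⊕ ζ^ T′ (+ r * b + + y * (+ 2 ^ s * b)))
      ≡⟨ cong (χ r •_) (∑-distrib-⊕ (upTo (2 ^ j)) _ _) ⟩
    χ r • (geomSum T′ s j (+ r * a) a ⊕ geomSum T′ s j (+ r * b) b) ∎

-- The characters (2/·) and (−1/·)

mod8-check : {P : ℕ → Set} (P? : ∀ v → Dec (P v)) {checked : True (allUpTo? P? 8)} (x : ℕ) → P (x % 8)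
mod8-check P? {checked} x = toWitness checked (ℕD.m%n<n x 8)

kron2-periodic : (r y : ℕ) → kron2 (r ℕ.+ y ℕ.* 8) ≡ kron2 r
kron2-periodic r y rewrite ℕD.[m+kn]%n≡m%n r y 8 {{_}} = refl

jacNeg1-periodic : (r y : ℕ) → jacNeg1 (r ℕ.+ y ℕ.* 4) ≡ jacNeg1 r
jacNeg1-periodic r y rewrite ℕD.[m+kn]%n≡m%n r y 4 {{_}} = refl

kron2-mod8 : (x : ℕ) → kron2 x ≡ kron2 (x % 8)
kron2-mod8 x = trans (cong kron2 (ℕD.m≡m%n+[m/n]*n x 8)) (kron2-periodic (x % 8) (x / 8))

jacNeg1-mod8 : (x : ℕ) → jacNeg1 x ≡ jacNeg1 (x % 8)
jacNeg1-mod8 x = trans (cong jacNeg1 (trans (ℕD.m≡m%n+[m/n]*n x 8) (cong (x % 8 ℕ.+_) (sym (ℕP.*-assoc (x / 8) 2 4)))))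
                       (jacNeg1-periodic (x % 8) (x / 8 ℕ.* 2))

kron2-cube : (x : ℕ) → kron2 x * (kron2 x * kron2 x) ≡ kron2 x
kron2-cube x rewrite kron2-mod8 x = mod8-check (λ v → kron2 v * (kron2 v * kron2 v) ℤ.≟ kron2 v) x

kron2-square : (x : ℕ) → kron2 x * kron2 x ≡ + (x % 2)
kron2-square x rewrite kron2-mod8 x | sym (ℕD.m∣n⇒o%n%m≡o%m 2 8 x (ℕ∣.divides 4 refl)) =
  mod8-check (λ v → kron2 v * kron2 v ℤ.≟ + (v % 2)) x

kron2-even : (x : ℕ) → x % 2 ≡ 0 → kron2 x ≡ + 0
kron2-even x x%2≡0 with ℤP.i*j≡0⇒i≡0∨j≡0 (kron2 x) (trans (kron2-square x) (cong +_ x%2≡0))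
... | inj₁ χ≡0 = χ≡0
... | inj₂ χ≡0 = χ≡0

jacNeg1-odd : (u : ℕ) → jacNeg1 (1 ℕ.+ u ℕ.* 2) ≡ (- + 1) ℤ.^ u
jacNeg1-odd zero          = refl
jacNeg1-odd (suc zero)    = refl
jacNeg1-odd (suc (suc u)) = begin
  jacNeg1 (1 ℕ.+ suc (suc u) ℕ.* 2)   ≡⟨ cong jacNeg1 (shift u) ⟩
  jacNeg1 ((1 ℕ.+ u ℕ.* 2) ℕ.+ 1 ℕ.* 4) ≡⟨ jacNeg1-periodic (1 ℕ.+ u ℕ.* 2) 1 ⟩
  jacNeg1 (1 ℕ.+ u ℕ.* 2)             ≡⟨ jacNeg1-odd u ⟩
  (- + 1) ℤ.^ u                       ≡⟨ double-negation ((- + 1) ℤ.^ u) ⟨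
  (- + 1) ℤ.^ suc (suc u)             ∎
  where
  open ≡-Reasoning
  double-negation : ∀ x → - + 1 * (- + 1 * x) ≡ x
  double-negation = solve-∀
  shift : ∀ u → 1 ℕ.+ suc (suc u) ℕ.* 2 ≡ (1 ℕ.+ u ℕ.* 2) ℕ.+ 1 ℕ.* 4
  shift = ℕSolver.solve-∀

kron2[-t]+kron2[2-t] : (t : ℕ) → kron2 ((- + t) %ℕ 8) + kron2 ((+ 2 - + t) %ℕ 8) ≡ kron2 t * (+ 1 + jacNeg1 t)
kron2[-t]+kron2[2-t] t = begin
  kron2 ((- + t) %ℕ 8) + kron2 ((+ 2 - + t) %ℕ 8)
    ≡⟨ cong₂ (λ a b → kron2 a + kron2 b) (%ℕ-cong 8 (- + v) (- + q) (trans (cong -_ +t≡) (neg-shift (+ v) (+ q))))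
                                          (%ℕ-cong 8 (+ 2 - + v) (- + q) (trans (cong (_-_ (+ 2)) +t≡) (neg-shift′ (+ v) (+ q)))) ⟩
  kron2 ((- + v) %ℕ 8) + kron2 ((+ 2 - + v) %ℕ 8)
    ≡⟨ mod8-check (λ v → kron2 ((- + v) %ℕ 8) + kron2 ((+ 2 - + v) %ℕ 8) ℤ.≟ kron2 v * (+ 1 + jacNeg1 v)) t ⟩
  kron2 v * (+ 1 + jacNeg1 v)
    ≡⟨ cong₂ (λ a b → a * (+ 1 + b)) (kron2-mod8 t) (jacNeg1-mod8 t) ⟨
  kron2 t * (+ 1 + jacNeg1 t) ∎
  where
  open ≡-Reasoning
  v = t % 8
  q = t / 8
  +t≡ : + t ≡ + v + + q * + 8
  +t≡ = trans (cong +_ (ℕD.m≡m%n+[m/n]*n t 8)) (cong (_+_ (+ v)) (ℤP.pos-* q 8))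
  neg-shift : ∀ v q → - (v + q * + 8) ≡ - v + - q * + 8
  neg-shift = solve-∀
  neg-shift′ : ∀ v q → + 2 - (v + q * + 8) ≡ (+ 2 - v) + - q * + 8
  neg-shift′ = solve-∀

module _ {c : ℤ} (c³≡c : c * (c * c) ≡ c) where

  ^-odd-tripotent : (k : ℕ) → c ℤ.^ suc (k ℕ.* 2) ≡ c
  ^-odd-tripotent zero    = ℤP.*-identityʳ c
  ^-odd-tripotent (suc k) = trans (cong (λ x → c * (c * x)) (^-odd-tripotent k)) c³≡c

  ^-even-tripotent : (k : ℕ) → c ℤ.^ (suc k ℕ.* 2) ≡ c * c
  ^-even-tripotent zero    = cong (c *_) (ℤP.*-identityʳ c)
  ^-even-tripotent (suc k) = trans (cong (λ x → c * (c * x)) (^-even-tripotent k)) (cong (c *_) c³≡c)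

-1^-even : (t : ℕ) → (- + 1) ℤ.^ (t ℕ.* 2) ≡ + 1
-1^-even zero    = refl
-1^-even (suc t) = cong (λ x → - + 1 * (- + 1 * x)) (-1^-even t)

-1^-odd : (u : ℕ) → (- + 1) ℤ.^ (1 ℕ.+ u ℕ.* 2) ≡ - + 1
-1^-odd u = cong (- + 1 *_) (-1^-even u)

-- ℤ[ζ₈] inside ℤ[ζ] and the Gauss sum of (2/·)

-- The inclusion ℤ[ζ_{2^(a+1)}] ⊆ ℤ[ζ_{2^(a+1+n)}], ζ ↦ ζ^(2^n).
embed : {a : ℕ} (n : ℕ) → Cyc (suc a) → Cyc (suc a ℕ.+ n)
embed {a} n u = ∑[ i ← allFin (2 ^ a) ] (coeff u i • ζ^ (suc a ℕ.+ n) (+ toℕ i * + 2 ^ n))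

module _ {a : ℕ} (n : ℕ) where

  private
    η : ℕ → Cyc (suc a ℕ.+ n)
    η i = ζ^ (suc a ℕ.+ n) (+ i * + 2 ^ n)

  embed-⊕ : (u v : Cyc (suc a)) → embed n (u ⊕ v) ≡ embed n u ⊕ embed n v
  embed-⊕ u v = trans (∑-cong (allFin _) λ i → trans (cong (_• η (toℕ i)) (coeff≡ (has-⊕ (has-coeff u) (has-coeff v)) i))
                                                      (•-distribʳ-+ (coeff u i) (coeff v i) (η (toℕ i))))
                      (∑-distrib-⊕ (allFin _) (λ i → coeff u i • η (toℕ i)) (λ i → coeff v i • η (toℕ i)))

  embed-• : (c : ℤ) (u : Cyc (suc a)) → embed n (c • u) ≡ c • embed n u
  embed-• c u = trans (∑-cong (allFin _) λ i → trans (cong (_• η (toℕ i)) (coeff≡ (has-• c (has-coeff u)) i))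
                                                     (sym (•-assoc c (coeff u i) (η (toℕ i)))))
                      (sym (•-distrib-∑ c (allFin _) (λ i → coeff u i • η (toℕ i))))

  embed-zero : embed n (zeroC (suc a)) ≡ zeroC (suc a ℕ.+ n)
  embed-zero = ∑-vanishes (allFin _) λ i → trans (cong (_• η (toℕ i)) (coeff≡ (has-zero {suc a}) i)) (•-zeroˡ (η (toℕ i)))

  embed-∑ : {A : Set} (xs : List A) (f : A → Cyc (suc a)) → embed n (∑ xs f) ≡ ∑[ x ← xs ] embed n (f x)
  embed-∑ []       f = embed-zero
  embed-∑ (x ∷ xs) f = trans (embed-⊕ (f x) (∑ xs f)) (cong (embed n (f x) ⊕_) (embed-∑ xs f))

  embed-ζ^-low : {r : ℕ} → r < 2 ^ a → embed n (ζ^ (suc a) (+ r)) ≡ η r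
  embed-ζ^-low r<h = trans (∑-cong (allFin _) λ i → cong (_• η (toℕ i)) (coeff-ζ^-low (suc a) r<h i)) (∑-δ r<h η)

  embed-ζ^ : (k : ℤ) → embed n (ζ^ (suc a) k) ≡ ζ^ (suc a ℕ.+ n) (k * + 2 ^ n)
  embed-ζ^ k = begin
    embed n (ζ^ (suc a) k)                          ≡⟨ cong (embed n) (ζ^-residue d) ⟩
    embed n ((- + 1) ℤ.^ ℓ • ζ^ (suc a) (+ r))      ≡⟨ embed-• ((- + 1) ℤ.^ ℓ) (ζ^ (suc a) (+ r)) ⟩
    (- + 1) ℤ.^ ℓ • embed n (ζ^ (suc a) (+ r))      ≡⟨ cong ((- + 1) ℤ.^ ℓ •_) (embed-ζ^-low residue<) ⟩
    (- + 1) ℤ.^ ℓ • η r                             ≡⟨ ζ^-split (a ℕ.+ n) ℓ (+ r * + 2 ^ n) p ⟨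
    ζ^ (suc a ℕ.+ n) ((+ r * + 2 ^ n + + (ℓ ℕ.* 2 ^ (a ℕ.+ n))) + p * + 2 ^ suc (a ℕ.+ n))
                                                    ≡⟨ cong (ζ^ (suc a ℕ.+ n)) k*2ⁿ≡ ⟨
    ζ^ (suc a ℕ.+ n) (k * + 2 ^ n)                  ∎
    where
    open ≡-Reasoning
    d = halfDecomposition a k
    open HalfDecomposition d renaming (residue to r; halves to ℓ; periods to p)
    scale : ∀ r ℓ p N H P → ((r + ℓ * H) + p * P) * N ≡ (r * N + ℓ * (H * N)) + p * (P * N)
    scale = solve-∀
    k*2ⁿ≡ : k * + 2 ^ n ≡ (+ r * + 2 ^ n + + (ℓ ℕ.* 2 ^ (a ℕ.+ n))) + p * + 2 ^ suc (a ℕ.+ n)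
    k*2ⁿ≡ = begin
      k * + 2 ^ n
        ≡⟨ cong (_* + 2 ^ n) (trans exponent≡ (cong (λ x → (+ r + x) + p * + 2 ^ suc a) (ℤP.pos-* ℓ (2 ^ a)))) ⟩
      ((+ r + + ℓ * + 2 ^ a) + p * + 2 ^ suc a) * + 2 ^ n
        ≡⟨ scale (+ r) (+ ℓ) p (+ 2 ^ n) (+ 2 ^ a) (+ 2 ^ suc a) ⟩
      (+ r * + 2 ^ n + + ℓ * (+ 2 ^ a * + 2 ^ n)) + p * (+ 2 ^ suc a * + 2 ^ n)
        ≡⟨ cong₂ (λ H P → (+ r * + 2 ^ n + + ℓ * H) + p * P) (+2^-+ a n) (+2^-+ (suc a) n) ⟨
      (+ r * + 2 ^ n + + ℓ * + 2 ^ (a ℕ.+ n)) + p * + 2 ^ suc (a ℕ.+ n)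
        ≡⟨ cong (λ x → (+ r * + 2 ^ n + x) + p * + 2 ^ suc (a ℕ.+ n)) (ℤP.pos-* ℓ (2 ^ (a ℕ.+ n))) ⟨
      (+ r * + 2 ^ n + + (ℓ ℕ.* 2 ^ (a ℕ.+ n))) + p * + 2 ^ suc (a ℕ.+ n) ∎

embed-sqrt2 : (n : ℕ) → embed n (sqrt2 3) ≡ sqrt2 (3 ℕ.+ n)
embed-sqrt2 n = trans (embed-⊕ n (ζ^ 3 (+ 1)) (ζ^ 3 (- + 1)))
  (cong₂ _⊕_ (trans (embed-ζ^ n (+ 1)) (cong (ζ^ (3 ℕ.+ n)) (ℤP.*-identityˡ (+ 2 ^ n))))
             (trans (embed-ζ^ n (- + 1)) (cong (ζ^ (3 ℕ.+ n)) (ℤP.-1*i≡-i (+ 2 ^ n)))))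

gaussSum₈ : ℤ → Cyc 3
gaussSum₈ a = ∑[ r ← upTo 8 ] (kron2 r • ζ^ 3 (+ r * a))

gaussSum₈-value : (a : ℤ) → gaussSum₈ a ≡ (+ 2 * kron2 (a %ℕ 8)) • sqrt2 3
gaussSum₈-value a = trans (∑-cong (upTo 8) λ r → cong (kron2 r •_) (ζ^-cong-mod 3 (+ r * + v) (+ r * q) (exponent r)))
                          (residues v (n%ℕd<d a 8))
  where
  v = a %ℕ 8
  q = a /ℕ 8
  distribute : ∀ r v q → r * (v + q * + 8) ≡ r * v + (r * q) * + 8
  distribute = solve-∀
  exponent : ∀ r → + r * a ≡ + r * + v + (+ r * q) * + 8
  exponent r = trans (cong (+ r *_) (a≡a%ℕn+[a/ℕn]*n a 8)) (distribute (+ r) (+ v) q)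
  residues : ∀ v → v < 8 → gaussSum₈ (+ v) ≡ (+ 2 * kron2 v) • sqrt2 3
  residues 0 _ = refl
  residues 1 _ = refl
  residues 2 _ = refl
  residues 3 _ = refl
  residues 4 _ = refl
  residues 5 _ = refl
  residues 6 _ = refl
  residues 7 _ = refl
  residues (suc (suc (suc (suc (suc (suc (suc (suc _)))))))) (s≤s (s≤s (s≤s (s≤s (s≤s (s≤s (s≤s (s≤s ()))))))))

module Even (k m : ℕ) where

  n = k ℕ.* 2
  T = suc (suc n)
  q = 2 ^ n
  h = 2 ^ suc n

  G : ℤ → Cyc T
  G a = geomSum T 1 (suc n) (+ 1 * a) a

  a₁ a₂ : ℤ
  a₁ = - + m
  a₂ = + q - + m

  kron2^T : (x : ℕ) → kron2 x ℤ.^ T ≡ + (x % 2)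
  kron2^T x = trans (^-even-tripotent (kron2-cube x) k) (kron2-square x)

  S-even : S T m ≡ G a₁ ⊕ G a₂
  S-even = begin
    S T m
      ≡⟨ S-fold (suc n) 1 (suc n) m refl (λ y r → trans (kron2^T (y ℕ.* 2 ℕ.+ r)) (sym (trans (kron2^T r) (cong +_ (parity y r))))) ⟩
    kron2 0 ℤ.^ T • (G₀ a₁ ⊕ G₀ a₂) ⊕ (kron2 1 ℤ.^ T • (G a₁ ⊕ G a₂) ⊕ zeroC T)
      ≡⟨ cong₂ (λ c d → c • (G₀ a₁ ⊕ G₀ a₂) ⊕ (d • (G a₁ ⊕ G a₂) ⊕ zeroC T)) (ℤP.*-zeroˡ ((+ 0) ℤ.^ suc n)) (ℤP.^-zeroˡ T) ⟩
    + 0 • (G₀ a₁ ⊕ G₀ a₂) ⊕ (+ 1 • (G a₁ ⊕ G a₂) ⊕ zeroC T)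
      ≡⟨ cong₂ _⊕_ (•-zeroˡ (G₀ a₁ ⊕ G₀ a₂)) (trans (⊕-identityʳ _) (•-identityˡ (G a₁ ⊕ G a₂))) ⟩
    zeroC T ⊕ (G a₁ ⊕ G a₂)
      ≡⟨ ⊕-identityˡ (G a₁ ⊕ G a₂) ⟩
    G a₁ ⊕ G a₂ ∎
    where
    open ≡-Reasoning
    G₀ : ℤ → Cyc T
    G₀ a = geomSum T 1 (suc n) (+ 0 * a) a
    parity : ∀ y r → r % 2 ≡ (y ℕ.* 2 ℕ.+ r) % 2
    parity y r = trans (sym (ℕD.[m+kn]%n≡m%n r y 2)) (cong (_% 2) (ℕP.+-comm r (y ℕ.* 2)))

  G-full : {a : ℤ} → + h ∣ℤ a → G a ≡ + h • ζ^ T (+ 1 * a)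
  G-full {a} = geomSum-full T 1 (suc n) (+ 1 * a) a refl

  G-vanishes : {a : ℤ} → ¬ (+ h ∣ℤ a) → G a ≡ zeroC T
  G-vanishes {a} = geomSum-vanishes T 1 (suc n) (+ 1 * a) a refl

  G-neg-half-multiple : (a : ℤ) (e : ℕ) → a ≡ - + (e ℕ.* h) → G a ≡ (+ h * (- + 1) ℤ.^ e) • oneC T
  G-neg-half-multiple a e a≡-eh = begin
    G a                                 ≡⟨ G-full (divides (- + e) (trans a≡-eh -eh≡[-e]h)) ⟩
    + h • ζ^ T (+ 1 * a)                ≡⟨ cong (λ x → + h • ζ^ T x) (trans (ℤP.*-identityˡ a) a≡-eh) ⟩
    + h • ζ^ T (- + (e ℕ.* h))          ≡⟨ cong (+ h •_) (ζ^-neg-half-multiple (suc n) e) ⟩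
    + h • ((- + 1) ℤ.^ e • oneC T)      ≡⟨ •-assoc (+ h) ((- + 1) ℤ.^ e) (oneC T) ⟩
    (+ h * (- + 1) ℤ.^ e) • oneC T      ∎
    where
    open ≡-Reasoning
    -eh≡[-e]h : - + (e ℕ.* h) ≡ - + e * + h
    -eh≡[-e]h = trans (cong -_ (ℤP.pos-* e h)) (ℤP.neg-distribˡ-* (+ e) (+ h))

  G-half-multiple : (e : ℕ) → m ≡ e ℕ.* h → G a₁ ≡ (+ h * (- + 1) ℤ.^ e) • oneC T
  G-half-multiple e m≡eh = G-neg-half-multiple a₁ e (cong (λ x → - + x) m≡eh)

  h∣m⇒h∤a₂ : h ∣ m → ¬ (+ h ∣ℤ a₂)
  h∣m⇒h∤a₂ h∣m h∣a₂ = ℕP.<⇒≱ (ℕP.^-monoʳ-< 2 (s≤s (s≤s z≤n)) (ℕP.n<1+n n))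
    (ℕ∣.∣⇒≤ {{m^n≢0 2 n}} (∣ℤ⇒∣ (subst (+ h ∣ℤ_) (cancel (+ q) (+ m)) (ℤ∣.∣m∣n⇒∣m+n h∣a₂ (ℤ∣.∣ᵤ⇒∣ h∣m)))))
    where cancel : ∀ q m → (q - m) + m ≡ q
          cancel = solve-∀

  S-2^T∣m : 2 ^ T ∣ m → S T m ≡ const T (+ (2 ^ T ∸ 2 ^ (T ∸ 1)))
  S-2^T∣m (ℕ∣.divides t m≡t*2^T) = begin
    S T m                                    ≡⟨ S-even ⟩
    G a₁ ⊕ G a₂                              ≡⟨ cong₂ _⊕_ (G-half-multiple (t ℕ.* 2) m≡2th) (G-vanishes (h∣m⇒h∤a₂ (ℕ∣.divides (t ℕ.* 2) m≡2th))) ⟩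
    (+ h * (- + 1) ℤ.^ (t ℕ.* 2)) • oneC T ⊕ zeroC T ≡⟨ ⊕-identityʳ _ ⟩
    (+ h * (- + 1) ℤ.^ (t ℕ.* 2)) • oneC T   ≡⟨ cong (λ c → (+ h * c) • oneC T) (-1^-even t) ⟩
    (+ h * + 1) • oneC T                     ≡⟨ cong (λ c → c • oneC T) (trans (ℤP.*-identityʳ (+ h)) (cong +_ (sym 2h∸h≡h))) ⟩
    const T (+ (2 ^ T ∸ h))                  ∎
    where
    open ≡-Reasoning
    m≡2th : m ≡ t ℕ.* 2 ℕ.* h
    m≡2th = trans m≡t*2^T (sym (ℕP.*-assoc t 2 h))
    2h∸h≡h : 2 ^ T ∸ h ≡ h
    2h∸h≡h = trans (ℕP.m+n∸m≡n h (h ℕ.+ 0)) (ℕP.+-identityʳ h)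

  S-2^[T∸1]∥m : 2 ^ (T ∸ 1) ∥ m → S T m ≡ const T (- (+ (2 ^ (T ∸ 1))))
  S-2^[T∸1]∥m h∥m@(h∣m , _) with ∥⇒odd-multiple h∥m
  ... | u , m≡[1+2u]h = begin
    S T m                                          ≡⟨ S-even ⟩
    G a₁ ⊕ G a₂                                    ≡⟨ cong₂ _⊕_ (G-half-multiple (1 ℕ.+ u ℕ.* 2) m≡[1+2u]h) (G-vanishes (h∣m⇒h∤a₂ h∣m)) ⟩
    (+ h * (- + 1) ℤ.^ (1 ℕ.+ u ℕ.* 2)) • oneC T ⊕ zeroC T ≡⟨ ⊕-identityʳ _ ⟩
    (+ h * (- + 1) ℤ.^ (1 ℕ.+ u ℕ.* 2)) • oneC T   ≡⟨ cong (λ c → (+ h * c) • oneC T) (-1^-odd u) ⟩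
    (+ h * - + 1) • oneC T                         ≡⟨ cong (_• oneC T) (trans (ℤP.*-comm (+ h) (- + 1)) (ℤP.-1*i≡-i (+ h))) ⟩
    const T (- + h)                                ∎
    where open ≡-Reasoning

  S-2^[T∸2]∥m : 2 ^ (T ∸ 2) ∥ m → S T m ≡ (+ (2 ^ (T ∸ 1)) * jacNeg1 ((m / 2 ^ (T ∸ 2)) {{m^n≢0 2 (T ∸ 2)}})) • oneC T
  S-2^[T∸2]∥m q∥m@(_ , 2q∤m) with ∥⇒odd-multiple q∥m
  ... | u , m≡[1+2u]q = begin
    S T m                                    ≡⟨ S-even ⟩
    G a₁ ⊕ G a₂                              ≡⟨ cong₂ _⊕_ (G-vanishes (λ h∣a₁ → 2q∤m (∣ℤ-neg⇒∣ h∣a₁))) (G-neg-half-multiple a₂ u a₂≡-uh) ⟩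
    zeroC T ⊕ (+ h * (- + 1) ℤ.^ u) • oneC T ≡⟨ ⊕-identityˡ _ ⟩
    (+ h * (- + 1) ℤ.^ u) • oneC T           ≡⟨ cong (λ c → (+ h * c) • oneC T) (trans (cong jacNeg1 m/q≡1+2u) (jacNeg1-odd u)) ⟨
    (+ h * jacNeg1 ((m / q) {{m^n≢0 2 n}})) • oneC T ∎
    where
    open ≡-Reasoning
    m/q≡1+2u : (m / q) {{m^n≢0 2 n}} ≡ 1 ℕ.+ u ℕ.* 2
    m/q≡1+2u = trans (cong (λ x → (x / q) {{m^n≢0 2 n}}) m≡[1+2u]q) (ℕD.m*n/n≡m (1 ℕ.+ u ℕ.* 2) q {{m^n≢0 2 n}})
    odd-multiple : ∀ u q → q - (+ 1 + u * + 2) * q ≡ - (u * (+ 2 * q))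
    odd-multiple = solve-∀
    a₂≡-uh : a₂ ≡ - + (u ℕ.* h)
    a₂≡-uh = begin
      + q - + m                             ≡⟨ cong (λ x → + q - + x) m≡[1+2u]q ⟩
      + q - + ((1 ℕ.+ u ℕ.* 2) ℕ.* q)       ≡⟨ cong (λ x → + q - x) (trans (ℤP.pos-* (1 ℕ.+ u ℕ.* 2) q) (cong (_* + q) (cong (_+_ (+ 1)) (ℤP.pos-* u 2)))) ⟩
      + q - (+ 1 + + u * + 2) * + q         ≡⟨ odd-multiple (+ u) (+ q) ⟩
      - (+ u * (+ 2 * + q))                 ≡⟨ cong (λ x → - (+ u * x)) (ℤP.pos-* 2 q) ⟨
      - (+ u * + h)                         ≡⟨ cong -_ (ℤP.pos-* u h) ⟨
      - + (u ℕ.* h)                         ∎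

  S-2^[T∸2]∤m : ¬ (2 ^ (T ∸ 2) ∣ m) → S T m ≡ zeroC T
  S-2^[T∸2]∤m q∤m = begin
    S T m             ≡⟨ S-even ⟩
    G a₁ ⊕ G a₂       ≡⟨ cong₂ _⊕_ (G-vanishes h∤a₁) (G-vanishes h∤a₂) ⟩
    zeroC T ⊕ zeroC T ≡⟨ ⊕-identityˡ (zeroC T) ⟩
    zeroC T           ∎
    where
    open ≡-Reasoning
    q∣h : + q ∣ℤ + h
    q∣h = ℤ∣.∣ᵤ⇒∣ (ℕ∣.n∣m*n 2)
    h∤a₁ : ¬ (+ h ∣ℤ a₁)
    h∤a₁ h∣a₁ = q∤m (ℕ∣.∣-trans (ℕ∣.n∣m*n 2) (∣ℤ-neg⇒∣ h∣a₁))
    cancel : ∀ q m → q - (q - m) ≡ m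
    cancel = solve-∀
    h∤a₂ : ¬ (+ h ∣ℤ a₂)
    h∤a₂ h∣a₂ = q∤m (∣ℤ⇒∣ (subst (+ q ∣ℤ_) (cancel (+ q) (+ m)) (ℤ∣.∣m∣n⇒∣m-n ℤ∣.∣-refl (ℤ∣.∣-trans q∣h h∣a₂))))

module Odd (k m : ℕ) where

  n = k ℕ.* 2
  T = 3 ℕ.+ n
  N = 2 ^ n

  G : ℕ → ℤ → Cyc T
  G r a = geomSum T 3 n (+ r * a) a

  a₁ a₂ : ℤ
  a₁ = - + m
  a₂ = + 2 ^ suc n - + m

  kron2^T : (x : ℕ) → kron2 x ℤ.^ T ≡ kron2 x
  kron2^T x = ^-odd-tripotent (kron2-cube x) (suc k)

  S-odd : S T m ≡ ∑[ r ← upTo 8 ] (kron2 r • (G r a₁ ⊕ G r a₂))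
  S-odd = trans (S-fold (suc (suc n)) 3 n m refl periodic)
                (∑-cong (upTo 8) λ r → cong (_• (G r a₁ ⊕ G r a₂)) (kron2^T r))
    where
    periodic : ∀ y r → kron2 (y ℕ.* 8 ℕ.+ r) ℤ.^ T ≡ kron2 r ℤ.^ T
    periodic y r = cong (ℤ._^ T) (trans (cong kron2 (ℕP.+-comm (y ℕ.* 8) r)) (kron2-periodic r y))

  S-odd-∤ : ¬ (N ∣ m) → S T m ≡ zeroC T
  S-odd-∤ N∤m = trans S-odd (∑-vanishes (upTo 8) λ r → begin
    kron2 r • (G r a₁ ⊕ G r a₂) ≡⟨ cong₂ (λ u v → kron2 r • (u ⊕ v)) (G-vanishes r N∤a₁) (G-vanishes r N∤a₂) ⟩
    kron2 r • (zeroC T ⊕ zeroC T) ≡⟨ cong (kron2 r •_) (⊕-identityˡ (zeroC T)) ⟩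
    kron2 r • zeroC T             ≡⟨ •-zeroʳ (kron2 r) ⟩
    zeroC T                       ∎)
    where
    open ≡-Reasoning
    G-vanishes : ∀ r {a} → ¬ (+ N ∣ℤ a) → G r a ≡ zeroC T
    G-vanishes r {a} = geomSum-vanishes T 3 n (+ r * a) a refl
    N∤a₁ : ¬ (+ N ∣ℤ a₁)
    N∤a₁ N∣a₁ = N∤m (∣ℤ-neg⇒∣ N∣a₁)
    cancel : ∀ q m → q - (q - m) ≡ m
    cancel = solve-∀
    N∤a₂ : ¬ (+ N ∣ℤ a₂)
    N∤a₂ N∣a₂ = N∤m (∣ℤ⇒∣ (subst (+ N ∣ℤ_) (cancel (+ 2 ^ suc n) (+ m))
      (ℤ∣.∣m∣n⇒∣m-n (ℤ∣.∣ᵤ⇒∣ {i = + 2 ^ suc n} (ℕ∣.n∣m*n 2)) N∣a₂)))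

  embed-gaussSum₈ : (a : ℤ) → embed n (gaussSum₈ a) ≡ ∑[ r ← upTo 8 ] (kron2 r • ζ^ T (+ r * a * + N))
  embed-gaussSum₈ a = trans (embed-∑ n (upTo 8) (λ r → kron2 r • ζ^ 3 (+ r * a)))
    (∑-cong (upTo 8) λ r → trans (embed-• n (kron2 r) (ζ^ 3 (+ r * a))) (cong (kron2 r •_) (embed-ζ^ n (+ r * a))))

  embed-gaussSum₈-value : (b : ℤ) → embed n (gaussSum₈ b) ≡ (+ 2 * kron2 (b %ℕ 8)) • sqrt2 T
  embed-gaussSum₈-value b = begin
    embed n (gaussSum₈ b)                                ≡⟨ cong (embed n) (gaussSum₈-value b) ⟩
    embed n ((+ 2 * kron2 (b %ℕ 8)) • sqrt2 3)           ≡⟨ embed-• n (+ 2 * kron2 (b %ℕ 8)) (sqrt2 3) ⟩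
    (+ 2 * kron2 (b %ℕ 8)) • embed n (sqrt2 3)           ≡⟨ cong ((+ 2 * kron2 (b %ℕ 8)) •_) (embed-sqrt2 n) ⟩
    (+ 2 * kron2 (b %ℕ 8)) • sqrt2 T                     ∎
    where open ≡-Reasoning

  S-odd-gauss : (t : ℕ) → m ≡ t ℕ.* N → S T m ≡ + N • (embed n (gaussSum₈ (- + t)) ⊕ embed n (gaussSum₈ (+ 2 - + t)))
  S-odd-gauss t m≡tN = begin
    S T m
      ≡⟨ S-odd ⟩
    ∑[ r ← upTo 8 ] (kron2 r • (G r a₁ ⊕ G r a₂))
      ≡⟨ ∑-cong (upTo 8) (λ r → cong (kron2 r •_) (cong₂ _⊕_ (G-full r a₁ (- + t) a₁≡) (G-full r a₂ (+ 2 - + t) a₂≡))) ⟩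
    ∑[ r ← upTo 8 ] (kron2 r • (+ N • ζ^ T (+ r * a₁) ⊕ + N • ζ^ T (+ r * a₂)))
      ≡⟨ ∑-cong (upTo 8) (λ r → swap-scalars (kron2 r) (ζ^ T (+ r * a₁)) (ζ^ T (+ r * a₂))) ⟩
    ∑[ r ← upTo 8 ] (+ N • (kron2 r • ζ^ T (+ r * a₁) ⊕ kron2 r • ζ^ T (+ r * a₂)))
      ≡⟨ •-distrib-∑ (+ N) (upTo 8) (λ r → kron2 r • ζ^ T (+ r * a₁) ⊕ kron2 r • ζ^ T (+ r * a₂)) ⟨
    + N • ∑[ r ← upTo 8 ] (kron2 r • ζ^ T (+ r * a₁) ⊕ kron2 r • ζ^ T (+ r * a₂))
      ≡⟨ cong (+ N •_) (∑-distrib-⊕ (upTo 8) (λ r → kron2 r • ζ^ T (+ r * a₁)) (λ r → kron2 r • ζ^ T (+ r * a₂))) ⟩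
    + N • (∑[ r ← upTo 8 ] (kron2 r • ζ^ T (+ r * a₁)) ⊕ ∑[ r ← upTo 8 ] (kron2 r • ζ^ T (+ r * a₂)))
      ≡⟨ cong (+ N •_) (cong₂ _⊕_ (lift (- + t) a₁≡) (lift (+ 2 - + t) a₂≡)) ⟩
    + N • (embed n (gaussSum₈ (- + t)) ⊕ embed n (gaussSum₈ (+ 2 - + t))) ∎
    where
    open ≡-Reasoning
    +m≡tN : + m ≡ + t * + N
    +m≡tN = trans (cong +_ m≡tN) (ℤP.pos-* t N)
    neg-factor : ∀ t N → - (t * N) ≡ - t * N
    neg-factor = solve-∀
    a₁≡ : a₁ ≡ - + t * + N
    a₁≡ = trans (cong -_ +m≡tN) (neg-factor (+ t) (+ N))
    diff-factor : ∀ t N → + 2 * N - t * N ≡ (+ 2 - t) * N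
    diff-factor = solve-∀
    a₂≡ : a₂ ≡ (+ 2 - + t) * + N
    a₂≡ = trans (cong₂ _-_ (ℤP.pos-* 2 N) +m≡tN) (diff-factor (+ t) (+ N))
    G-full : ∀ r a b → a ≡ b * + N → G r a ≡ + N • ζ^ T (+ r * a)
    G-full r a b a≡bN = geomSum-full T 3 n (+ r * a) a refl (divides b a≡bN)
    swap : ∀ c d (u : Cyc T) → c • (d • u) ≡ d • (c • u)
    swap c d u = trans (•-assoc c d u) (trans (cong (_• u) (ℤP.*-comm c d)) (sym (•-assoc d c u)))
    swap-scalars : ∀ c (u v : Cyc T) → c • (+ N • u ⊕ + N • v) ≡ + N • (c • u ⊕ c • v)
    swap-scalars c u v = trans (•-distribˡ-⊕ c (+ N • u) (+ N • v))
      (trans (cong₂ _⊕_ (swap c (+ N) u) (swap c (+ N) v)) (sym (•-distribˡ-⊕ (+ N) (c • u) (c • v))))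
    reassoc : ∀ r b N → r * (b * N) ≡ r * b * N
    reassoc = solve-∀
    lift : ∀ b {a} → a ≡ b * + N → ∑[ r ← upTo 8 ] (kron2 r • ζ^ T (+ r * a)) ≡ embed n (gaussSum₈ b)
    lift b a≡bN = trans (∑-cong (upTo 8) λ r → cong (λ x → kron2 r • ζ^ T x) (trans (cong (+ r *_) a≡bN) (reassoc (+ r) b (+ N))))
                        (sym (embed-gaussSum₈ b))

  S-odd-∣ : (t : ℕ) → m ≡ t ℕ.* N → S T m ≡ (+ N * (+ 2 * (kron2 t * (+ 1 + jacNeg1 t)))) • sqrt2 T
  S-odd-∣ t m≡tN = begin
    S T m
      ≡⟨ S-odd-gauss t m≡tN ⟩
    + N • (embed n (gaussSum₈ (- + t)) ⊕ embed n (gaussSum₈ (+ 2 - + t)))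
      ≡⟨ cong (+ N •_) (cong₂ _⊕_ (embed-gaussSum₈-value (- + t)) (embed-gaussSum₈-value (+ 2 - + t))) ⟩
    + N • (c₁ • sqrt2 T ⊕ c₂ • sqrt2 T)
      ≡⟨ cong (+ N •_) (•-distribʳ-+ c₁ c₂ (sqrt2 T)) ⟨
    + N • ((c₁ + c₂) • sqrt2 T)
      ≡⟨ •-assoc (+ N) (c₁ + c₂) (sqrt2 T) ⟩
    (+ N * (c₁ + c₂)) • sqrt2 T
      ≡⟨ cong (λ c → (+ N * c) • sqrt2 T) (trans (sym (ℤP.*-distribˡ-+ (+ 2) χ₁ χ₂)) (cong (+ 2 *_) (kron2[-t]+kron2[2-t] t))) ⟩
    (+ N * (+ 2 * (kron2 t * (+ 1 + jacNeg1 t)))) • sqrt2 T ∎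
    where
    open ≡-Reasoning
    χ₁ = kron2 ((- + t) %ℕ 8)
    χ₂ = kron2 ((+ 2 - + t) %ℕ 8)
    c₁ = + 2 * χ₁
    c₂ = + 2 * χ₂

  S-2^[T∸3]∥m : 2 ^ (T ∸ 3) ∥ m →
                S T m ≡ (+ (2 ^ (T ∸ 2)) * kron2 ((m / 2 ^ (T ∸ 3)) {{m^n≢0 2 (T ∸ 3)}}))
                          • (sqrt2 T ⊗ (oneC T ⊕ jacNeg1 ((m / 2 ^ (T ∸ 3)) {{m^n≢0 2 (T ∸ 3)}}) • oneC T))
  S-2^[T∸3]∥m (ℕ∣.divides t m≡tN , _) = begin
    S T m
      ≡⟨ S-odd-∣ t m≡tN ⟩
    (+ N * (+ 2 * (kron2 t * (+ 1 + jacNeg1 t)))) • sqrt2 T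
      ≡⟨ cong (_• sqrt2 T) (regroup (+ N) (kron2 t) (jacNeg1 t)) ⟩
    (+ 2 * + N * kron2 t * (+ 1 + jacNeg1 t)) • sqrt2 T
      ≡⟨ •-assoc (+ 2 * + N * kron2 t) (+ 1 + jacNeg1 t) (sqrt2 T) ⟨
    (+ 2 * + N * kron2 t) • ((+ 1 + jacNeg1 t) • sqrt2 T)
      ≡⟨ cong₂ _•_ (cong (_* kron2 t) (ℤP.pos-* 2 N)) (sqrt2-⊗ (suc (suc n)) (jacNeg1 t)) ⟨
    (+ (2 ℕ.* N) * kron2 t) • (sqrt2 T ⊗ (oneC T ⊕ jacNeg1 t • oneC T))
      ≡⟨ cong (λ x → (+ (2 ℕ.* N) * kron2 x) • (sqrt2 T ⊗ (oneC T ⊕ jacNeg1 x • oneC T))) m/N≡t ⟨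
    (+ (2 ℕ.* N) * kron2 ((m / N) {{m^n≢0 2 n}})) • (sqrt2 T ⊗ (oneC T ⊕ jacNeg1 ((m / N) {{m^n≢0 2 n}}) • oneC T)) ∎
    where
    open ≡-Reasoning
    regroup : ∀ N χ j → N * (+ 2 * (χ * (+ 1 + j))) ≡ + 2 * N * χ * (+ 1 + j)
    regroup = solve-∀
    m/N≡t : (m / N) {{m^n≢0 2 n}} ≡ t
    m/N≡t = trans (cong (λ x → (x / N) {{m^n≢0 2 n}}) m≡tN) (ℕD.m*n/n≡m t N {{m^n≢0 2 n}})

  S-2^[T∸3]∦m : ¬ (2 ^ (T ∸ 3) ∥ m) → S T m ≡ zeroC T
  S-2^[T∸3]∦m N∦m with N ℕ∣.∣? m
  ... | no N∤m = S-odd-∤ N∤m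
  ... | yes N∣m@(ℕ∣.divides t m≡tN) with 2 ℕ.* N ℕ∣.∣? m
  ...   | no 2N∤m  = ⊥-elim (N∦m (N∣m , 2N∤m))
  ...   | yes 2N∣m = begin
    S T m                                                   ≡⟨ S-odd-∣ t m≡tN ⟩
    (+ N * (+ 2 * (kron2 t * (+ 1 + jacNeg1 t)))) • sqrt2 T  ≡⟨ cong (λ χ → (+ N * (+ 2 * (χ * (+ 1 + jacNeg1 t)))) • sqrt2 T) (kron2-even t t%2≡0) ⟩
    (+ N * (+ 2 * (+ 0 * (+ 1 + jacNeg1 t)))) • sqrt2 T      ≡⟨ cong (_• sqrt2 T) (annihilate (+ N) (jacNeg1 t)) ⟩
    + 0 • sqrt2 T                                           ≡⟨ •-zeroˡ (sqrt2 T) ⟩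
    zeroC T                                                 ∎
    where
    open ≡-Reasoning
    t%2≡0 : t % 2 ≡ 0
    t%2≡0 = ℕ∣.n∣m⇒m%n≡0 t 2 (ℕ∣.*-cancelʳ-∣ N {{m^n≢0 2 n}} (subst (2 ℕ.* N ∣_) m≡tN 2N∣m))
    annihilate : ∀ N j → N * (+ 2 * (+ 0 * (+ 1 + j))) ≡ + 0
    annihilate = solve-∀

elim-even : {P : ℕ → Set} {b : ℕ} → ((k : ℕ) → P (suc k ℕ.* 2)) → (T : ℕ) → suc b ≤ T → T % 2 ≡ 0 → P T
elim-even p T b<T T%2≡0 with ℕ∣.m%n≡0⇒n∣m T 2 T%2≡0
... | ℕ∣.divides (suc k) refl = p k
... | ℕ∣.divides zero    refl with () ← b<T

elim-odd : {P : ℕ → Set} {b : ℕ} → ((k : ℕ) → P (3 ℕ.+ k ℕ.* 2)) → (T : ℕ) → suc (suc b) ≤ T → T % 2 ≡ 1 → P T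
elim-odd {P} p T b+1<T T%2≡1 with T / 2 | ℕD.m≡m%n+[m/n]*n T 2
... | suc k | T≡1+2k rewrite T%2≡1 = subst P (sym T≡1+2k) (p k)
... | zero  | T≡1   rewrite T%2≡1 | T≡1 with s≤s () ← b+1<T

-- The formulas also hold for m = 0.
proposition11p4 : (m : ℕ) → 0 < m →
    -- (1) T ≥ 4 even
    ((T : ℕ) → 4 ≤ T → T % 2 ≡ 0 →
        ((2 ^ T ∣ m) → S T m ≡ const T (+ (2 ^ T ∸ 2 ^ (T ∸ 1))))
      × ((2 ^ (T ∸ 1) ∥ m) → S T m ≡ const T (- (+ (2 ^ (T ∸ 1)))))
      × ((2 ^ (T ∸ 2) ∥ m) →
           S T m ≡ (+ (2 ^ (T ∸ 1)) Data.Integer.* jacNeg1 ((m / 2 ^ (T ∸ 2)) {{m^n≢0 2 (T ∸ 2)}})) • oneC T)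
      × (¬ (2 ^ (T ∸ 2) ∣ m) → S T m ≡ zeroC T))
    -- (2) T = 2
    × (((4 ∣ m) → S 2 m ≡ const 2 (+ 2))
      × ((2 ∥ m) → S 2 m ≡ const 2 (- (+ 2)))
      × (¬ (2 ∣ m) → S 2 m ≡ const 2 (+ 2 Data.Integer.* jacNeg1 m)))
    -- (3) T ≥ 5 odd
    × ((T : ℕ) → 5 ≤ T → T % 2 ≡ 1 →
        ((2 ^ (T ∸ 3) ∥ m) →
           S T m ≡ (+ (2 ^ (T ∸ 2)) Data.Integer.* kron2 ((m / 2 ^ (T ∸ 3)) {{m^n≢0 2 (T ∸ 3)}}))
                     • (sqrt2 T ⊗ (oneC T ⊕ jacNeg1 ((m / 2 ^ (T ∸ 3)) {{m^n≢0 2 (T ∸ 3)}}) • oneC T)))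
      × (¬ (2 ^ (T ∸ 3) ∥ m) → S T m ≡ zeroC T))
    -- (4) T = 3
    × ((¬ (2 ∣ m) →
           S 3 m ≡ (+ 2 Data.Integer.* kron2 m) • (sqrt2 3 ⊗ (oneC 3 ⊕ jacNeg1 m • oneC 3)))
      × ((2 ∣ m) → S 3 m ≡ zeroC 3))
proposition11p4 m _ =
    elim-even (λ k → Even.S-2^T∣m k m , Even.S-2^[T∸1]∥m k m , Even.S-2^[T∸2]∥m k m , Even.S-2^[T∸2]∤m k m)
  , ( Even.S-2^T∣m 0 m , Even.S-2^[T∸1]∥m 0 m
    , λ 2∤m → trans (Even.S-2^[T∸2]∥m 0 m (ℕ∣.1∣ m , 2∤m)) (cong (λ x → const 2 (+ 2 * jacNeg1 x)) (ℕD.n/1≡n m)))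
  , elim-odd (λ k → Odd.S-2^[T∸3]∥m k m , Odd.S-2^[T∸3]∦m k m)
  , ( (λ 2∤m → trans (Odd.S-2^[T∸3]∥m 0 m (ℕ∣.1∣ m , 2∤m))
                     (cong (λ x → (+ 2 * kron2 x) • (sqrt2 3 ⊗ (oneC 3 ⊕ jacNeg1 x • oneC 3))) (ℕD.n/1≡n m)))
    , λ 2∣m → Odd.S-2^[T∸3]∦m 0 m λ (_ , 2∤m) → 2∤m 2∣m)
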